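{- Let $R$ be a commutative ring, $n\ge1$, and $x_1,\dots,x_n\in R$. For integers $0\le e_1<\cdots<e_n$ let $M(e_1,\dots,e_n)=\det\big(x_i^{e_j}\big)_{1\le i,j\le n}$. Assume $e_n\ge n$ and put $r=e_n-n+1$. For $m=1,\dots,n$ let $p_m=(-1)^{n-m}\sigma_{n-m+1}(x_1,\dots,x_n)$, where $\sigma_t$ is the $t$-th elementary symmetric polynomial. Let $P$ be the $e_n\times r$ matrix with entries \[P_{i,j}=\begin{cases}p_{i-j+1}, & j\le i\le j+n-1,\\ -1,& i=j+n,\\ 0,&\text{otherwise},\end{cases}\] and let $Q$ be the $r\times r$ matrix obtained from $P$ by deleting the rows with indices $e_1+1,\dots,e_{n-1}+1$. Then \[M(e_1,\dots,e_n)=(-1)^{\frac{n(n-1)}{2}+\sum_{i=1}^{n-1}(e_i+1)}\cdot\det Q\cdot M(0,1,\dots,n-1).\]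
   Context: $M(e_1,\dots,e_n)$ is the generalized Vandermonde determinant; $M(e_1,\dots,e_n)/M(0,1,\dots,n-1)$ is the Schur function. -}

module Defs where

open import Level using (Level)
open import Algebra.Bundles using (CommutativeRing)
open import Data.Nat as ℕ using (ℕ; zero; suc; _∸_; _≡ᵇ_; _<ᵇ_)
open import Data.Nat.DivMod using (_/_)
open import Data.Bool using (Bool; true; false; not; _∨_; if_then_else_)
open import Data.Fin as Fin using (Fin; zero; suc; toℕ; fromℕ; inject₁; punchIn)
open import Data.List using (List; []; _∷_; upTo; filterᵇ)

nth : List ℕ → ℕ → ℕ
nth []       _       = 0
nth (x ∷ xs) zero    = x
nth (x ∷ xs) (suc i) = nth xs i

-- Data for n = suc k: exponents e : Fin (suc k) → ℕ, last exponent e_n = e (fromℕ k).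
-- Row (0-indexed) i is deleted iff i = e_a for some a among the first n-1 indices
-- (i.e. the 1-indexed row i+1 equals e_a + 1).
deleted : {k : ℕ} → (Fin (suc k) → ℕ) → ℕ → Bool
deleted {zero}  e i = false
deleted {suc k} e i = (e zero ≡ᵇ i) ∨ deleted {k} (λ a → e (suc a)) i

keptRows : {k : ℕ} → (Fin (suc k) → ℕ) → List ℕ
keptRows {k} e = filterᵇ (λ i → not (deleted e i)) (upTo (e (fromℕ k)))

rOf : {k : ℕ} → (Fin (suc k) → ℕ) → ℕ
rOf {k} e = e (fromℕ k) ∸ k

expSum : {k : ℕ} → (Fin (suc k) → ℕ) → ℕ
expSum {zero}  e = 0
expSum {suc k} e = suc (e zero) ℕ.+ expSum {k} (λ a → e (suc a))

module _ {c ℓ : Level} (R : CommutativeRing c ℓ) where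
  open CommutativeRing R using (Carrier; _+_; _*_; -_; 0#; 1#)

  ∑ : {n : ℕ} → (Fin n → Carrier) → Carrier
  ∑ {zero}  f = 0#
  ∑ {suc n} f = f zero + ∑ (λ i → f (suc i))

  pow : Carrier → ℕ → Carrier
  pow x zero    = 1#
  pow x (suc k) = x * pow x k

  sgn : ℕ → Carrier
  sgn zero    = 1#
  sgn (suc k) = - sgn k

  det : {n : ℕ} → (Fin n → Fin n → Carrier) → Carrier
  det {zero}  A = 1#
  det {suc n} A = ∑ (λ j → sgn (toℕ j) * (A zero j * det (λ i k → A (suc i) (punchIn j k))))

  esym : {n : ℕ} → ℕ → (Fin n → Carrier) → Carrier
  esym zero    x = 1#
  esym {zero}  (suc t) x = 0#
  esym {suc n} (suc t) x = esym (suc t) (λ i → x (suc i)) + x zero * esym t (λ i → x (suc i))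

  genVdm : {n : ℕ} → (Fin n → Carrier) → (Fin n → ℕ) → Carrier
  genVdm x e = det (λ i j → pow (x i) (e j))

  -- p_m = (-1)^{n-m} σ_{n-m+1}(x), for 1 ≤ m ≤ n  (m given 1-indexed)
  pcoef : {n : ℕ} → (Fin n → Carrier) → ℕ → Carrier
  pcoef {n} x m = sgn (n ∸ m) * esym (suc (n ∸ m)) x

  -- The matrix P, with 1-indexed entries P_{I,J}; here given 0-indexed: P i j = P_{i+1,j+1}.
  --   P_{I,J} = p_{I-J+1} if J ≤ I ≤ J+n-1,  -1 if I = J+n,  0 otherwise.
  Pmat : {n : ℕ} → (Fin n → Carrier) → ℕ → ℕ → Carrier
  Pmat {n} x i j =
    if (i <ᵇ j) then 0#
    else if ((i ∸ j) <ᵇ n) then pcoef x (suc (i ∸ j))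
    else if ((i ∸ j) ≡ᵇ n) then - 1#
    else 0#

  Qmat : {k : ℕ} → (Fin (suc k) → Carrier) → (e : Fin (suc k) → ℕ) →
         Fin (rOf e) → Fin (rOf e) → Carrier
  Qmat x e i j = Pmat x (nth (keptRows e) (toℕ i)) (toℕ j)

module Submission where

-- Write n = k + 1, V = M(0,1,…,n-1) and, for exponents ε : Fin n → ℕ,
-- M(ε) = det (x_i ^ ε_j).  For a set of rows κ : Fin l → ℕ of P let Q(κ) be
-- the l × l matrix of those rows (columns 0 … l-1).  The heart of the proof
-- (`reduction`) is: whenever κ and ε are increasing and together enumerate
-- {0, …, l+n-1} exactly once,
--     det Q(κ) · V  ≈  (-1)^(Σ_b b + Σ ε + l) · M(ε).
-- This goes by induction on l, looking at where the largest value l+n-1 sits.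
--   * If it is the last row of Q(κ), that row is (0,…,0,-1): expand along it.
--   * If it is the last exponent ε_k, every x_i is a root of ∏(z - x_j), so
--     x_i^(l+n-1) = Σ_m P_{m,l-1} x_i^m; expanding the last column of M(ε) by
--     multilinearity leaves exactly the terms m = κ_a, which match the
--     expansion of det Q(κ) along its last column term by term.
-- The theorem is the instance κ = keptRows e, ε = e, plus sign bookkeeping.

open import Defs
open import Level using (Level)
open import Algebra.Bundles using (CommutativeRing; CommutativeMonoid)
open import Data.Nat as ℕ using (ℕ; zero; suc; _∸_; z≤n; s≤s; _<ᵇ_; _≡ᵇ_)
import Data.Nat.Properties as ℕP
open import Data.Nat.DivMod using (_/_; m*n/n≡m)
open import Data.Nat.Tactic.RingSolver using (solve-∀)
open import Data.Bool using (Bool; true; false; not; _∨_; T; if_then_else_)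
import Data.Bool.Properties as BoolP
open import Data.Fin as Fin using (Fin; zero; suc; toℕ; fromℕ; fromℕ<; inject₁; punchIn; punchOut)
import Data.Fin.Properties as FinP
open import Data.List using (List; []; _∷_; _++_; length; upTo; filterᵇ)
import Data.List.Properties as ListP
open import Data.Product using (∃; _×_; _,_; proj₁; proj₂)
open import Data.Sum using (_⊎_; inj₁; inj₂)
open import Data.Empty using (⊥-elim)
open import Function using (_∘_)
open import Function.Bundles using (Equivalence)
open import Relation.Nullary using (yes; no)
open import Relation.Nullary.Decidable using (T?)
open import Relation.Binary.Definitions using (tri<; tri≈; tri>)
open import Relation.Binary.PropositionalEquality as ≡ using (_≡_; _≢_)

<ᵇ-true : ∀ {m n} → m ℕ.< n → (m <ᵇ n) ≡ true
<ᵇ-true m<n = Equivalence.to BoolP.T-≡ (ℕP.<⇒<ᵇ m<n)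

<ᵇ-false : ∀ {m n} → n ℕ.≤ m → (m <ᵇ n) ≡ false
<ᵇ-false {m}     {zero}  _         = ≡.refl
<ᵇ-false {suc m} {suc n} (s≤s n≤m) = <ᵇ-false n≤m

<ᵇ-true⇒< : ∀ m n → (m <ᵇ n) ≡ true → m ℕ.< n
<ᵇ-true⇒< m n eq = ℕP.<ᵇ⇒< m n (Equivalence.from BoolP.T-≡ eq)

<ᵇ-false⇒≥ : ∀ m n → (m <ᵇ n) ≡ false → n ℕ.≤ m
<ᵇ-false⇒≥ m n eq = ℕP.≮⇒≥ (λ m<n → ≡.subst T eq (ℕP.<⇒<ᵇ m<n))

≡ᵇ-refl : ∀ m → (m ≡ᵇ m) ≡ true
≡ᵇ-refl m = Equivalence.to BoolP.T-≡ (ℕP.≡⇒≡ᵇ m m ≡.refl)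

≡ᵇ-false : ∀ {m n} → m ≢ n → (m ≡ᵇ n) ≡ false
≡ᵇ-false {m} {n} m≢n with m ≡ᵇ n in eq
... | false = ≡.refl
... | true  = ⊥-elim (m≢n (ℕP.≡ᵇ⇒≡ m n (Equivalence.from BoolP.T-≡ eq)))

Increasing : ∀ {m} → (Fin m → ℕ) → Set
Increasing f = ∀ {i j} → i Fin.< j → f i ℕ.< f j

Increasing-injective : ∀ {m} {f : Fin m → ℕ} → Increasing f → ∀ {i j} → f i ≡ f j → i ≡ j
Increasing-injective inc {i} {j} eq with FinP.<-cmp i j
... | tri< i<j _ _ = ⊥-elim (ℕP.<⇒≢ (inc i<j) eq)
... | tri≈ _ i≡j _ = i≡j
... | tri> _ _ j<i = ⊥-elim (ℕP.<⇒≢ (inc j<i) (≡.sym eq))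

Increasing-inject₁ : ∀ {m} {f : Fin (suc m) → ℕ} → Increasing f → Increasing (f ∘ inject₁)
Increasing-inject₁ inc {i} {j} i<j =
  inc (≡.subst₂ ℕ._<_ (≡.sym (FinP.toℕ-inject₁ i)) (≡.sym (FinP.toℕ-inject₁ j)) i<j)

Increasing-suc : ∀ {m} {f : Fin (suc m) → ℕ} → Increasing f → Increasing (f ∘ suc)
Increasing-suc inc i<j = inc (s≤s i<j)

Increasing-head-gap : ∀ {m} (f : Fin (suc m) → ℕ) → Increasing f → ∀ b → f zero ℕ.+ toℕ b ℕ.≤ f b
Increasing-head-gap f inc zero = ℕP.≤-reflexive (ℕP.+-identityʳ _)
Increasing-head-gap {suc m} f inc (suc b) = ℕP.≤-trans (ℕP.≤-reflexive (ℕP.+-suc (f zero) (toℕ b)))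
  (ℕP.≤-trans (ℕP.+-monoˡ-≤ (toℕ b) (inc {zero} {suc zero} (s≤s z≤n)))
              (Increasing-head-gap (f ∘ suc) (Increasing-suc inc) b))

Increasing-gap : ∀ {m} (f : Fin m → ℕ) → Increasing f →
                 ∀ i j → toℕ i ℕ.≤ toℕ j → f i ℕ.+ (toℕ j ∸ toℕ i) ℕ.≤ f j
Increasing-gap {suc m} f inc zero j _ = Increasing-head-gap f inc j
Increasing-gap {suc m} f inc (suc i) (suc j) (s≤s i≤j) = Increasing-gap (f ∘ suc) (Increasing-suc inc) i j i≤j

<-fromℕ : ∀ {m} (b : Fin (suc m)) → b ≢ fromℕ m → b Fin.< fromℕ m
<-fromℕ {m} b b≢m = ℕP.≤∧≢⇒< (FinP.≤fromℕ b) (b≢m ∘ FinP.toℕ-injective)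

not-fromℕ⇒inject₁ : ∀ {m} (b : Fin (suc m)) → b ≢ fromℕ m → ∃ λ b′ → inject₁ b′ ≡ b
not-fromℕ⇒inject₁ {m} b b≢m = _ , FinP.inject₁-lower₁ b m≢b
  where
  m≢b : m ≢ toℕ b
  m≢b m≡b = b≢m (FinP.toℕ-injective (≡.trans (≡.sym m≡b) (≡.sym (FinP.toℕ-fromℕ m))))

record Partition (N : ℕ) {l m : ℕ} (κ : Fin l → ℕ) (ε : Fin m → ℕ) : Set where
  field
    κ<    : ∀ a → κ a ℕ.< N
    ε<    : ∀ b → ε b ℕ.< N
    disj  : ∀ a b → κ a ≢ ε b
    cover : ∀ v → v ℕ.< N → (∃ λ a → κ a ≡ v) ⊎ (∃ λ b → ε b ≡ v)

Partition-swap : ∀ {N l m} {κ : Fin l → ℕ} {ε : Fin m → ℕ} → Partition N κ ε → Partition N ε κ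
Partition-swap p = record
  { κ< = ε< ; ε< = κ< ; disj = λ a b eq → disj b a (≡.sym eq)
  ; cover = λ v v<N → Data.Sum.swap (cover v v<N) }
  where open Partition p

partition-max-last : ∀ {N l m} {κ : Fin (suc l) → ℕ} {ε : Fin m → ℕ} →
  Partition (suc N) κ ε → Increasing κ → ∀ a → κ a ≡ N → κ (fromℕ l) ≡ N
partition-max-last {N} {l} {κ = κ} p inc a κa≡N with a FinP.≟ fromℕ l
... | yes ≡.refl = κa≡N
... | no a≢l = ⊥-elim (ℕP.<⇒≱ (≡.subst (ℕ._< κ (fromℕ l)) κa≡N (inc (<-fromℕ a a≢l)))
                               (ℕP.≤-pred (Partition.κ< p (fromℕ l))))

partition-dropLast : ∀ {N l m} {κ : Fin (suc l) → ℕ} {ε : Fin m → ℕ} →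
  Partition (suc N) κ ε → Increasing κ → κ (fromℕ l) ≡ N → Partition N (κ ∘ inject₁) ε
partition-dropLast {N} {l} {κ = κ} {ε} p inc top = record
  { κ< = λ a → ≡.subst (κ (inject₁ a) ℕ.<_) top (inc (<-fromℕ (inject₁ a) (FinP.fromℕ≢inject₁ ∘ ≡.sym)))
  ; ε< = λ b → ℕP.≤∧≢⇒< (ℕP.≤-pred (ε< b)) (λ εb≡N → disj (fromℕ l) b (≡.trans top (≡.sym εb≡N)))
  ; disj = λ a → disj (inject₁ a)
  ; cover = cover′ }
  where
  open Partition p
  cover′ : ∀ v → v ℕ.< N → (∃ λ a → κ (inject₁ a) ≡ v) ⊎ (∃ λ b → ε b ≡ v)
  cover′ v v<N with cover v (ℕP.m≤n⇒m≤1+n v<N)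
  ... | inj₂ found = inj₂ found
  ... | inj₁ (a , κa≡v) with a FinP.≟ fromℕ l
  ...   | yes ≡.refl = ⊥-elim (ℕP.<⇒≢ v<N (≡.trans (≡.sym κa≡v) top))
  ...   | no a≢l with not-fromℕ⇒inject₁ a a≢l
  ...     | a′ , ≡.refl = inj₁ (a′ , κa≡v)

insert : ∀ {m} → Fin (suc m) → (Fin m → ℕ) → ℕ → Fin (suc m) → ℕ
insert zero    f v zero    = v
insert zero    f v (suc j) = f j
insert {suc m} (suc t) f v zero    = f zero
insert {suc m} (suc t) f v (suc j) = insert t (f ∘ suc) v j

insert-at : ∀ {m} (t : Fin (suc m)) f v → insert t f v t ≡ v
insert-at zero    f v = ≡.refl
insert-at {suc m} (suc t) f v = insert-at t (f ∘ suc) v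

insert-punchIn : ∀ {m} (t : Fin (suc m)) f v j → insert t f v (punchIn t j) ≡ f j
insert-punchIn zero    f v j = ≡.refl
insert-punchIn {suc m} (suc t) f v zero    = ≡.refl
insert-punchIn {suc m} (suc t) f v (suc j) = insert-punchIn t (f ∘ suc) v j

insert-values : ∀ {m} (t : Fin (suc m)) f v j → insert t f v j ≡ v ⊎ ∃ λ b → insert t f v j ≡ f b
insert-values zero    f v zero    = inj₁ ≡.refl
insert-values zero    f v (suc j) = inj₂ (j , ≡.refl)
insert-values {suc m} (suc t) f v zero    = inj₂ (zero , ≡.refl)
insert-values {suc m} (suc t) f v (suc j) with insert-values t (f ∘ suc) v j
... | inj₁ eq       = inj₁ eq
... | inj₂ (b , eq) = inj₂ (suc b , eq)

insert-increasing : ∀ {m} (t : Fin (suc m)) f v → Increasing f →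
  (∀ b → toℕ b ℕ.< toℕ t → f b ℕ.< v) → (∀ b → toℕ t ℕ.≤ toℕ b → v ℕ.< f b) →
  Increasing (insert t f v)
insert-increasing zero f v inc below above {zero}  {suc j} _         = above j z≤n
insert-increasing zero f v inc below above {suc i} {suc j} (s≤s i<j) = inc i<j
insert-increasing {suc m} (suc t) f v inc below above {zero} {suc j} _ with insert-values t (f ∘ suc) v j
... | inj₁ eq       = ≡.subst (f zero ℕ.<_) (≡.sym eq) (below zero (s≤s z≤n))
... | inj₂ (b , eq) = ≡.subst (f zero ℕ.<_) (≡.sym eq) (inc {zero} {suc b} (s≤s z≤n))
insert-increasing {suc m} (suc t) f v inc below above {suc i} {suc j} (s≤s i<j) =
  insert-increasing t (f ∘ suc) v (Increasing-suc inc) (λ b → below (suc b) ∘ s≤s) (λ b → above (suc b) ∘ s≤s) i<j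

position : ∀ {m} → (Fin m → ℕ) → ℕ → Fin (suc m)
position {zero}  f v = zero
position {suc m} f v = if f zero <ᵇ v then suc (position (f ∘ suc) v) else zero

position-below : ∀ {m} (f : Fin m → ℕ) v → Increasing f → ∀ b → toℕ b ℕ.< toℕ (position f v) → f b ℕ.< v
position-below {suc m} f v inc b b<t with f zero <ᵇ v in eq
position-below {suc m} f v inc zero    _         | true = <ᵇ-true⇒< _ _ eq
position-below {suc m} f v inc (suc b) (s≤s b<t) | true = position-below (f ∘ suc) v (Increasing-suc inc) b b<t

position-above : ∀ {m} (f : Fin m → ℕ) v → Increasing f → (∀ b → f b ≢ v) →
                 ∀ b → toℕ (position f v) ℕ.≤ toℕ b → v ℕ.< f b
position-above {suc m} f v inc f≢v b t≤b with f zero <ᵇ v in eq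
position-above {suc m} f v inc f≢v b       _         | false =
  ℕP.<-≤-trans (ℕP.≤∧≢⇒< (<ᵇ-false⇒≥ _ _ eq) (f≢v zero ∘ ≡.sym))
               (ℕP.≤-trans (ℕP.m≤m+n (f zero) (toℕ b)) (Increasing-head-gap f inc b))
position-above {suc m} f v inc f≢v (suc b) (s≤s t≤b) | true =
  position-above (f ∘ suc) v (Increasing-suc inc) (f≢v ∘ suc) b t≤b

module RangeSums {a b : Level} (M : CommutativeMonoid a b) where
  open CommutativeMonoid M renaming (ε to unit)
  open import Algebra.Properties.CommutativeMonoid.Sum M public using (sum)
  open import Algebra.Properties.CommutativeMonoid.Sum M using (sum-cong-≋; sum-cong-≗; sum-init-last)
  open import Relation.Binary.Reasoning.Setoid setoid

  Σ< : ℕ → (ℕ → Carrier) → Carrier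
  Σ< N g = sum {N} (g ∘ toℕ)

  Σ<-cong : ∀ N {f g : ℕ → Carrier} → (∀ s → s ℕ.< N → f s ≈ g s) → Σ< N f ≈ Σ< N g
  Σ<-cong N f≈g = sum-cong-≋ (λ i → f≈g (toℕ i) (FinP.toℕ<n i))

  Σ<-snoc : ∀ N g → Σ< (suc N) g ≈ Σ< N g ∙ g N
  Σ<-snoc N g = begin
    Σ< (suc N) g                                ≈⟨ sum-init-last (g ∘ toℕ) ⟩
    sum {N} (g ∘ toℕ ∘ inject₁) ∙ g (toℕ (fromℕ N)) ≡⟨ ≡.cong₂ _∙_ (sum-cong-≗ {N} (≡.cong g ∘ FinP.toℕ-inject₁))
                                                                (≡.cong g (FinP.toℕ-fromℕ N)) ⟩
    Σ< N g ∙ g N                                ∎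

  Σ<-split : ∀ m n g → Σ< (m ℕ.+ n) g ≈ Σ< m g ∙ Σ< n (λ t → g (m ℕ.+ t))
  Σ<-split zero    n g = sym (identityˡ _)
  Σ<-split (suc m) n g = trans (∙-congˡ (Σ<-split m n (g ∘ suc))) (sym (assoc _ _ _))

  Σ<-reverse : ∀ N g → Σ< N (λ s → g (N ∸ suc s)) ≈ Σ< N g
  Σ<-reverse zero    g = refl
  Σ<-reverse (suc N) g = begin
    g N ∙ Σ< N (λ s → g (N ∸ suc s)) ≈⟨ ∙-congˡ (Σ<-reverse N g) ⟩
    g N ∙ Σ< N g                     ≈⟨ comm _ _ ⟩
    Σ< N g ∙ g N                     ≈⟨ Σ<-snoc N g ⟨
    Σ< (suc N) g                     ∎

  Σ<-partition : ∀ N {l m} (κ : Fin l → ℕ) (ε : Fin m → ℕ) → Increasing κ → Increasing ε →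
                 Partition N κ ε → (g : ℕ → Carrier) → Σ< N g ≈ sum (g ∘ κ) ∙ sum (g ∘ ε)
  Σ<-partition zero {zero}  {zero}  κ ε incκ incε p g = sym (identityˡ unit)
  Σ<-partition zero {suc l}         κ ε incκ incε p g = ⊥-elim (ℕP.n≮0 (Partition.κ< p zero))
  Σ<-partition zero {zero}  {suc m} κ ε incκ incε p g = ⊥-elim (ℕP.n≮0 (Partition.ε< p zero))
  Σ<-partition (suc N) κ ε incκ incε p g with Partition.cover p N ℕP.≤-refl
  Σ<-partition (suc N) {suc l} κ ε incκ incε p g | inj₁ (a , κa≡N) = begin
    Σ< (suc N) g                                     ≈⟨ Σ<-snoc N g ⟩
    Σ< N g ∙ g N                                     ≈⟨ ∙-congʳ (Σ<-partition N (κ ∘ inject₁) ε (Increasing-inject₁ incκ) incε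
                                                          (partition-dropLast p incκ top) g) ⟩
    (sum (g ∘ κ ∘ inject₁) ∙ sum (g ∘ ε)) ∙ g N     ≈⟨ rearrange _ _ _ ⟩
    (sum (g ∘ κ ∘ inject₁) ∙ g N) ∙ sum (g ∘ ε)     ≈⟨ ∙-congʳ (sym (trans (sum-init-last (g ∘ κ)) (∙-congˡ (reflexive (≡.cong g top))))) ⟩
    sum (g ∘ κ) ∙ sum (g ∘ ε)                       ∎
    where
    top = partition-max-last p incκ a κa≡N
    rearrange : ∀ x y z → (x ∙ y) ∙ z ≈ (x ∙ z) ∙ y
    rearrange x y z = trans (assoc _ _ _) (trans (∙-congˡ (comm y z)) (sym (assoc _ _ _)))
  Σ<-partition (suc N) {zero} κ ε incκ incε p g | inj₁ (() , _)
  Σ<-partition (suc N) {l} {suc m} κ ε incκ incε p g | inj₂ (b , εb≡N) = begin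
    Σ< (suc N) g                                     ≈⟨ Σ<-snoc N g ⟩
    Σ< N g ∙ g N                                     ≈⟨ ∙-congʳ (Σ<-partition N κ (ε ∘ inject₁) incκ (Increasing-inject₁ incε)
                                                          (Partition-swap (partition-dropLast (Partition-swap p) incε top)) g) ⟩
    (sum (g ∘ κ) ∙ sum (g ∘ ε ∘ inject₁)) ∙ g N     ≈⟨ assoc _ _ _ ⟩
    sum (g ∘ κ) ∙ (sum (g ∘ ε ∘ inject₁) ∙ g N)     ≈⟨ ∙-congˡ (sym (trans (sum-init-last (g ∘ ε)) (∙-congˡ (reflexive (≡.cong g top))))) ⟩
    sum (g ∘ κ) ∙ sum (g ∘ ε)                       ∎
    where top = partition-max-last (Partition-swap p) incε b εb≡N
  Σ<-partition (suc N) {l} {zero} κ ε incκ incε p g | inj₂ (() , _)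

open RangeSums ℕP.+-0-commutativeMonoid using ()
  renaming (sum to Σℕ; Σ< to Σℕ<; Σ<-snoc to Σℕ<-snoc; Σ<-partition to Σℕ<-partition)
open import Algebra.Properties.CommutativeMonoid.Sum ℕP.+-0-commutativeMonoid using ()
  renaming (sum-init-last to Σℕ-init-last; sum-cong-≗ to Σℕ-cong; sum-replicate-zero to Σℕ-zero)
open import Algebra.Properties.CommutativeSemigroup ℕP.+-commutativeSemigroup using ()
  renaming (x∙yz≈y∙xz to x+[y+z]≡y+[x+z])

[_<_] : ℕ → ℕ → ℕ
[ v < u ] = if v <ᵇ u then 1 else 0

[<]-one : ∀ {v u} → v ℕ.< u → [ v < u ] ≡ 1
[<]-one v<u rewrite <ᵇ-true v<u = ≡.refl

[<]-zero : ∀ {v u} → u ℕ.≤ v → [ v < u ] ≡ 0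
[<]-zero u≤v rewrite <ᵇ-false u≤v = ≡.refl

count-range : ∀ N u → u ℕ.≤ N → Σℕ< N (λ v → [ v < u ]) ≡ u
count-range N       zero    _         = Σℕ-zero N
count-range (suc N) (suc u) (s≤s u≤N) = ≡.cong suc (count-range N u u≤N)

count-increasing : ∀ {l} (κ : Fin l → ℕ) → Increasing κ → ∀ a → Σℕ (λ a′ → [ κ a′ < κ a ]) ≡ toℕ a
count-increasing {suc l} κ inc zero =
  ≡.cong₂ ℕ._+_ ([<]-zero (ℕP.≤-refl {κ zero}))
                (≡.trans (Σℕ-cong {l} (λ i → [<]-zero (ℕP.<⇒≤ (inc {zero} {suc i} (s≤s z≤n))))) (Σℕ-zero l))
count-increasing {suc l} κ inc (suc a) =
  ≡.cong₂ ℕ._+_ ([<]-one (inc {zero} {suc a} (s≤s z≤n))) (count-increasing (κ ∘ suc) (Increasing-suc inc) a)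

count-position : ∀ {m} (f : Fin m → ℕ) v → Increasing f → Σℕ (λ b → [ f b < v ]) ≡ toℕ (position f v)
count-position {zero}  f v inc = ≡.refl
count-position {suc m} f v inc with f zero <ᵇ v in eq
... | true  = ≡.cong suc (count-position (f ∘ suc) v (Increasing-suc inc))
... | false = ≡.trans (Σℕ-cong {m} (λ b → [<]-zero (ℕP.≤-trans (<ᵇ-false⇒≥ (f zero) v eq) (ℕP.<⇒≤ (inc {zero} {suc b} (s≤s z≤n))))))
                      (Σℕ-zero m)

Σℕ-insert : ∀ {m} (t : Fin (suc m)) f v → Σℕ (insert t f v) ≡ v ℕ.+ Σℕ f
Σℕ-insert zero    f v = ≡.refl
Σℕ-insert {suc m} (suc t) f v = ≡.trans (≡.cong (f zero ℕ.+_) (Σℕ-insert t (f ∘ suc) v)) (x+[y+z]≡y+[x+z] (f zero) v _)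

increasing-below-length : ∀ {k} (ε : Fin (suc k) → ℕ) → Increasing ε → (∀ b → ε b ℕ.< suc k) → ∀ b → ε b ≡ toℕ b
increasing-below-length {k} ε inc ε<n b = ℕP.≤-antisym upper lower
  where
  lower : toℕ b ℕ.≤ ε b
  lower = ℕP.≤-trans (ℕP.m≤n+m (toℕ b) (ε zero)) (Increasing-head-gap ε inc b)
  b≤k : toℕ b ℕ.≤ k
  b≤k = ℕP.≤-pred (FinP.toℕ<n b)
  gap : ε b ℕ.+ (k ∸ toℕ b) ℕ.≤ toℕ b ℕ.+ (k ∸ toℕ b)
  gap = begin
    ε b ℕ.+ (k ∸ toℕ b)                ≡⟨ ≡.cong (λ z → ε b ℕ.+ (z ∸ toℕ b)) (FinP.toℕ-fromℕ k) ⟨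
    ε b ℕ.+ (toℕ (fromℕ k) ∸ toℕ b)    ≤⟨ Increasing-gap ε inc b (fromℕ k) (≡.subst (toℕ b ℕ.≤_) (≡.sym (FinP.toℕ-fromℕ k)) b≤k) ⟩
    ε (fromℕ k)                        ≤⟨ ℕP.≤-pred (ε<n (fromℕ k)) ⟩
    k                                  ≡⟨ ℕP.m+[n∸m]≡n b≤k ⟨
    toℕ b ℕ.+ (k ∸ toℕ b)              ∎
    where open ℕP.≤-Reasoning
  upper : ε b ℕ.≤ toℕ b
  upper = ℕP.+-cancelʳ-≤ (k ∸ toℕ b) (ε b) (toℕ b) gap

τ : ∀ {n} → Fin (suc n) → Fin (suc (suc n)) → Fin (suc (suc n))
τ zero zero          = suc zero
τ zero (suc zero)    = zero
τ zero (suc (suc j)) = suc (suc j)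
τ {suc n} (suc c) zero    = zero
τ {suc n} (suc c) (suc j) = suc (τ c j)

τ-left : ∀ {n} (c : Fin (suc n)) → τ c (inject₁ c) ≡ suc c
τ-left zero          = ≡.refl
τ-left {suc n} (suc c) = ≡.cong suc (τ-left c)

τ-right : ∀ {n} (c : Fin (suc n)) → τ c (suc c) ≡ inject₁ c
τ-right zero          = ≡.refl
τ-right {suc n} (suc c) = ≡.cong suc (τ-right c)

τ-other : ∀ {n} (c : Fin (suc n)) j → j ≢ inject₁ c → j ≢ suc c → τ c j ≡ j
τ-other zero zero          j≢c _    = ⊥-elim (j≢c ≡.refl)
τ-other zero (suc zero)    _   j≢c′ = ⊥-elim (j≢c′ ≡.refl)
τ-other zero (suc (suc j)) _   _    = ≡.refl
τ-other {suc n} (suc c) zero    _ _ = ≡.refl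
τ-other {suc n} (suc c) (suc j) j≢c j≢c′ = ≡.cong suc (τ-other c j (j≢c ∘ ≡.cong suc) (j≢c′ ∘ ≡.cong suc))

σ : ∀ {n} → Fin (suc n) → Fin (suc n) → Fin (suc n)
σ c zero    = c
σ c (suc j) = punchIn c j

σ-suc : ∀ {n} (c : Fin (suc n)) j → σ (suc c) j ≡ τ c (σ (inject₁ c) j)
σ-suc c zero = ≡.sym (τ-left c)
σ-suc zero (suc zero)    = ≡.refl
σ-suc zero (suc (suc j)) = ≡.refl
σ-suc {suc n} (suc c) (suc zero)    = ≡.refl
σ-suc {suc n} (suc c) (suc (suc j)) = ≡.cong suc (σ-suc c (suc j))

σ-zero : ∀ {n} (j : Fin (suc n)) → σ zero j ≡ j
σ-zero zero    = ≡.refl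
σ-zero (suc j) = ≡.refl

inject₁≢suc : ∀ {n} (c : Fin n) → inject₁ c ≢ suc c
inject₁≢suc zero    ()
inject₁≢suc (suc c) eq = inject₁≢suc c (FinP.suc-injective eq)

punchIn-fromℕ : ∀ {n} (a : Fin n) → punchIn (fromℕ n) a ≡ inject₁ a
punchIn-fromℕ zero    = ≡.refl
punchIn-fromℕ (suc a) = ≡.cong suc (punchIn-fromℕ a)

punchIn-mono-< : ∀ {n} (a : Fin (suc n)) (i j : Fin n) → i Fin.< j → punchIn a i Fin.< punchIn a j
punchIn-mono-< zero    i       j       i<j       = s≤s i<j
punchIn-mono-< (suc a) zero    (suc j) _         = s≤s z≤n
punchIn-mono-< (suc a) (suc i) (suc j) (s≤s i<j) = s≤s (punchIn-mono-< a i j i<j)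

adjacent-in-minor : ∀ {n} (c : Fin (suc n)) (j : Fin (suc (suc n))) → j ≢ inject₁ c → j ≢ suc c →
  ∃ λ c′ → punchIn j (inject₁ c′) ≡ inject₁ c × punchIn j (suc c′) ≡ suc c
adjacent-in-minor zero zero       j≢c _    = ⊥-elim (j≢c ≡.refl)
adjacent-in-minor zero (suc zero) _   j≢c′ = ⊥-elim (j≢c′ ≡.refl)
adjacent-in-minor {suc n} zero    (suc (suc j)) _ _ = zero , ≡.refl , ≡.refl
adjacent-in-minor {suc n} (suc c) zero          _ _ = c , ≡.refl , ≡.refl
adjacent-in-minor {suc n} (suc c) (suc j) j≢c j≢c′
  with adjacent-in-minor c j (j≢c ∘ ≡.cong suc) (j≢c′ ∘ ≡.cong suc)
... | c′ , p , q = suc c′ , ≡.cong suc p , ≡.cong suc q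

punchIn-adjacent : ∀ {n} (c : Fin (suc n)) (k : Fin (suc n)) →
  punchIn (inject₁ c) k ≡ punchIn (suc c) k ⊎ (punchIn (inject₁ c) k ≡ suc c × punchIn (suc c) k ≡ inject₁ c)
punchIn-adjacent zero zero    = inj₂ (≡.refl , ≡.refl)
punchIn-adjacent zero (suc k) = inj₁ ≡.refl
punchIn-adjacent {suc n} (suc c) zero    = inj₁ ≡.refl
punchIn-adjacent {suc n} (suc c) (suc k) with punchIn-adjacent c k
... | inj₁ eq          = inj₁ (≡.cong suc eq)
... | inj₂ (eq₁ , eq₂) = inj₂ (≡.cong suc eq₁ , ≡.cong suc eq₂)

-- Suppose κ, ε partition
-- {0, …, N} and ε ends with N; let f be ε without its last entry.  Moving any
-- row value κ a from κ into f (at its position) gives again a partition, now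
-- of {0, …, N-1}; moreover κ a = a + (its position in f), since the values
-- below κ a are exactly a values of κ and position values of f.
record MovedRow (N : ℕ) {l k : ℕ} (κ : Fin (suc l) → ℕ) (f : Fin k → ℕ) (a : Fin (suc l)) : Set where
  field
    rows-increasing      : Increasing (κ ∘ punchIn a)
    exponents-increasing : Increasing (insert (position f (κ a)) f (κ a))
    partition            : Partition N (κ ∘ punchIn a) (insert (position f (κ a)) f (κ a))
    rank                 : toℕ a ℕ.+ toℕ (position f (κ a)) ≡ κ a

move-row : ∀ {N l k} (κ : Fin (suc l) → ℕ) (ε : Fin (suc k) → ℕ) → Increasing κ → Increasing ε →
           Partition (suc N) κ ε → ε (fromℕ k) ≡ N → (a : Fin (suc l)) → MovedRow N κ (ε ∘ inject₁) a
move-row {N} κ ε incκ incε p top a = record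
  { rows-increasing = λ {i} {j} i<j → incκ (punchIn-mono-< a i j i<j)
  ; exponents-increasing = insert-increasing t f v incf (position-below f v incf) (position-above f v incf f≢v)
  ; partition = partition
  ; rank = rank }
  where
  f = ε ∘ inject₁
  v = κ a
  t = position f v
  incf = Increasing-inject₁ incε
  p′ : Partition N κ f
  p′ = Partition-swap (partition-dropLast (Partition-swap p) incε top)
  f≢v : ∀ b → f b ≢ v
  f≢v b eq = Partition.disj p′ a b (≡.sym eq)
  rank : toℕ a ℕ.+ toℕ t ≡ v
  rank = begin
    toℕ a ℕ.+ toℕ t                                            ≡⟨ ≡.cong₂ ℕ._+_ (count-increasing κ incκ a) (count-position f v incf) ⟨
    Σℕ (λ a′ → [ κ a′ < v ]) ℕ.+ Σℕ (λ b → [ f b < v ])         ≡⟨ Σℕ<-partition N κ f incκ incf p′ (λ u → [ u < v ]) ⟨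
    Σℕ< N (λ u → [ u < v ])                                    ≡⟨ count-range N v (ℕP.<⇒≤ (Partition.κ< p′ a)) ⟩
    v                                                          ∎
    where open ≡.≡-Reasoning
  partition : Partition N (κ ∘ punchIn a) (insert t f v)
  partition = record { κ< = λ a′ → Partition.κ< p′ (punchIn a a′) ; ε< = ε< ; disj = disj ; cover = cover }
    where
    ε< : ∀ j → insert t f v j ℕ.< N
    ε< j with insert-values t f v j
    ... | inj₁ eq       = ≡.subst (ℕ._< N) (≡.sym eq) (Partition.κ< p′ a)
    ... | inj₂ (b , eq) = ≡.subst (ℕ._< N) (≡.sym eq) (Partition.ε< p′ b)
    disj : ∀ a′ j → κ (punchIn a a′) ≢ insert t f v j
    disj a′ j eq with insert-values t f v j
    ... | inj₁ eq′       = FinP.punchInᵢ≢i a a′ (Increasing-injective incκ (≡.trans eq eq′))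
    ... | inj₂ (b , eq′) = Partition.disj p′ (punchIn a a′) b (≡.trans eq eq′)
    cover : ∀ u → u ℕ.< N → (∃ λ a′ → κ (punchIn a a′) ≡ u) ⊎ (∃ λ j → insert t f v j ≡ u)
    cover u u<N with Partition.cover p′ u u<N
    ... | inj₂ (b , eq) = inj₂ (punchIn t b , ≡.trans (insert-punchIn t f v b) eq)
    ... | inj₁ (a″ , eq) with a FinP.≟ a″
    ...   | yes ≡.refl = inj₂ (t , ≡.trans (insert-at t f v) eq)
    ...   | no a≢a″    = inj₁ (punchOut a≢a″ , ≡.trans (≡.cong κ (FinP.punchIn-punchOut a≢a″)) eq)

module Determinants {c ℓ : Level} (R : CommutativeRing c ℓ) where
  open CommutativeRing R hiding (zero)
  open import Relation.Binary.Reasoning.Setoid setoid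
  open import Algebra.Properties.Ring ring using (-‿distribˡ-*; -‿distribʳ-*)
  open import Algebra.Properties.Group +-group using (⁻¹-involutive; inverseʳ-unique)
  open import Algebra.Properties.CommutativeSemigroup *-commutativeSemigroup using (x∙yz≈y∙xz)
  open import Algebra.Properties.Semiring.Sum semiring
    using (sum-cong-≋; sum-cong-≗; sum-remove; sum-replicate-zero; ∑-distrib-+; ∑-comm; *-distribˡ-sum; *-distribʳ-sum)
  open RangeSums +-commutativeMonoid public

  Mat : ℕ → Set c
  Mat n = Fin n → Fin n → Carrier

  ∑≡sum : ∀ {n} (f : Fin n → Carrier) → ∑ R f ≡ sum f
  ∑≡sum {zero}  f = ≡.refl
  ∑≡sum {suc n} f = ≡.cong (f zero +_) (∑≡sum (f ∘ suc))

  ∑-cong : ∀ {n} {f g : Fin n → Carrier} → (∀ i → f i ≈ g i) → ∑ R f ≈ ∑ R g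
  ∑-cong {n} {f} {g} f≈g = begin
    ∑ R f ≡⟨ ∑≡sum f ⟩ sum {n} f ≈⟨ sum-cong-≋ f≈g ⟩ sum {n} g ≡⟨ ∑≡sum g ⟨ ∑ R g ∎

  ∑-+ : ∀ {n} (f g : Fin n → Carrier) → ∑ R (λ i → f i + g i) ≈ ∑ R f + ∑ R g
  ∑-+ {n} f g = begin
    ∑ R (λ i → f i + g i)     ≡⟨ ∑≡sum (λ i → f i + g i) ⟩
    sum {n} (λ i → f i + g i) ≈⟨ ∑-distrib-+ f g ⟩
    sum f + sum g             ≡⟨ ≡.cong₂ _+_ (∑≡sum f) (∑≡sum g) ⟨
    ∑ R f + ∑ R g         ∎

  ∑-*ˡ : ∀ {n} a (f : Fin n → Carrier) → ∑ R (λ i → a * f i) ≈ a * ∑ R f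
  ∑-*ˡ {n} a f = begin
    ∑ R (λ i → a * f i) ≡⟨ ∑≡sum (λ i → a * f i) ⟩
    sum {n} (λ i → a * f i) ≈⟨ *-distribˡ-sum a f ⟨
    a * sum f           ≡⟨ ≡.cong (a *_) (∑≡sum f) ⟨
    a * ∑ R f           ∎

  ∑-*ʳ : ∀ {n} (f : Fin n → Carrier) a → ∑ R f * a ≈ ∑ R (λ i → f i * a)
  ∑-*ʳ {n} f a = begin
    ∑ R f * a           ≡⟨ ≡.cong (_* a) (∑≡sum f) ⟩
    sum f * a           ≈⟨ *-distribʳ-sum a f ⟩
    sum {n} (λ i → f i * a) ≡⟨ ∑≡sum (λ i → f i * a) ⟨
    ∑ R (λ i → f i * a) ∎

  ∑-swap : ∀ {m n} (f : Fin m → Fin n → Carrier) → ∑ R (λ i → ∑ R (f i)) ≈ ∑ R (λ j → ∑ R (λ i → f i j))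
  ∑-swap {m} {n} f = begin
    ∑ R (λ i → ∑ R (f i))                 ≡⟨ ≡.trans (∑≡sum (λ i → ∑ R (f i))) (sum-cong-≗ {m} (λ i → ∑≡sum (f i))) ⟩
    sum {m} (λ i → sum {n} (f i))         ≈⟨ ∑-comm f ⟩
    sum {n} (λ j → sum {m} (λ i → f i j)) ≡⟨ ≡.trans (∑≡sum (λ j → ∑ R (λ i → f i j))) (sum-cong-≗ {n} (λ j → ∑≡sum (λ i → f i j))) ⟨
    ∑ R (λ j → ∑ R (λ i → f i j)) ∎

  ∑-zero : ∀ {n} (f : Fin n → Carrier) → (∀ i → f i ≈ 0#) → ∑ R f ≈ 0#
  ∑-zero {n} f f≈0 = trans (∑-cong f≈0) (trans (reflexive (∑≡sum {n} _)) (sum-replicate-zero n))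

  ∑-single : ∀ {n} (f : Fin (suc n) → Carrier) (k : Fin (suc n)) → (∀ i → i ≢ k → f i ≈ 0#) → ∑ R f ≈ f k
  ∑-single {n} f k others = begin
    ∑ R f                        ≡⟨ ∑≡sum f ⟩
    sum f                        ≈⟨ sum-remove f ⟩
    f k + sum {n} (f ∘ punchIn k) ≡⟨ ≡.cong (f k +_) (∑≡sum (f ∘ punchIn k)) ⟨
    f k + ∑ R (f ∘ punchIn k)    ≈⟨ +-congˡ (∑-zero _ (λ i → others (punchIn k i) (FinP.punchInᵢ≢i k i))) ⟩
    f k + 0#                     ≈⟨ +-identityʳ _ ⟩
    f k                          ∎

  sgn-+ : ∀ a b → sgn R (a ℕ.+ b) ≈ sgn R a * sgn R b
  sgn-+ zero    b = sym (*-identityˡ _)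
  sgn-+ (suc a) b = trans (-‿cong (sgn-+ a b)) (-‿distribˡ-* _ _)

  sgn-square : ∀ a → sgn R a * sgn R a ≈ 1#
  sgn-square zero    = *-identityˡ 1#
  sgn-square (suc a) = begin
    - sgn R a * - sgn R a     ≈⟨ -‿distribˡ-* _ _ ⟨
    - (sgn R a * - sgn R a)   ≈⟨ -‿cong (-‿distribʳ-* _ _) ⟨
    - - (sgn R a * sgn R a)   ≈⟨ ⁻¹-involutive _ ⟩
    sgn R a * sgn R a         ≈⟨ sgn-square a ⟩
    1#                        ∎

  sgn-parity : ∀ X Y a b → X ℕ.+ (a ℕ.+ a) ≡ Y ℕ.+ (b ℕ.+ b) → sgn R X ≈ sgn R Y
  sgn-parity X Y a b eq = begin
    sgn R X                        ≈⟨ *-identityʳ _ ⟨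
    sgn R X * 1#                   ≈⟨ *-congˡ (trans (sgn-+ a a) (sgn-square a)) ⟨
    sgn R X * sgn R (a ℕ.+ a)      ≈⟨ sgn-+ X _ ⟨
    sgn R (X ℕ.+ (a ℕ.+ a))        ≡⟨ ≡.cong (sgn R) eq ⟩
    sgn R (Y ℕ.+ (b ℕ.+ b))        ≈⟨ sgn-+ Y _ ⟩
    sgn R Y * sgn R (b ℕ.+ b)      ≈⟨ *-congˡ (trans (sgn-+ b b) (sgn-square b)) ⟩
    sgn R Y * 1#                   ≈⟨ *-identityʳ _ ⟩
    sgn R Y                        ∎

  sgn-cancel : ∀ k x y → sgn R k * x ≈ y → x ≈ sgn R k * y
  sgn-cancel k x y eq = begin
    x                         ≈⟨ *-identityˡ x ⟨
    1# * x                    ≈⟨ *-congʳ (sgn-square k) ⟨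
    (sgn R k * sgn R k) * x   ≈⟨ *-assoc _ _ _ ⟩
    sgn R k * (sgn R k * x)   ≈⟨ *-congˡ eq ⟩
    sgn R k * y               ∎

  det-cong : ∀ {n} {A B : Mat n} → (∀ i j → A i j ≈ B i j) → det R A ≈ det R B
  det-cong {zero}  A≈B = refl
  det-cong {suc n} A≈B = ∑-cong λ j → *-congˡ {sgn R (toℕ j)} (*-cong (A≈B zero j) (det-cong λ i k → A≈B (suc i) (punchIn j k)))

  minor₀ : ∀ {n} → Mat (suc n) → Fin (suc n) → Mat n
  minor₀ A j i k = A (suc i) (punchIn j k)

  term : ∀ {n} → Mat (suc n) → Fin (suc n) → Carrier
  term A j = sgn R (toℕ j) * (A zero j * det R (minor₀ A j))

  scale-+ : ∀ s α X β Y → s * (α * X + β * Y) ≈ α * (s * X) + β * (s * Y)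
  scale-+ s α X β Y = trans (distribˡ s _ _) (+-cong (x∙yz≈y∙xz s α X) (x∙yz≈y∙xz s β Y))

  det-linear : ∀ {n} (c : Fin n) (A B C : Mat n) (α β : Carrier) →
    (∀ i j → j ≢ c → A i j ≈ B i j) → (∀ i j → j ≢ c → A i j ≈ C i j) →
    (∀ i → A i c ≈ α * B i c + β * C i c) → det R A ≈ α * det R B + β * det R C
  det-linear {suc n} c A B C α β A≈B A≈C column = begin
    ∑ R (term A)                                         ≈⟨ ∑-cong termwise ⟩
    ∑ R (λ j → α * term B j + β * term C j)              ≈⟨ ∑-+ (λ j → α * term B j) (λ j → β * term C j) ⟩
    ∑ R (λ j → α * term B j) + ∑ R (λ j → β * term C j)  ≈⟨ +-cong (∑-*ˡ α (term B)) (∑-*ˡ β (term C)) ⟩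
    α * det R B + β * det R C                            ∎
    where
    entry×minor : ∀ j → A zero j * det R (minor₀ A j)
                      ≈ α * (B zero j * det R (minor₀ B j)) + β * (C zero j * det R (minor₀ C j))
    entry×minor j with j FinP.≟ c
    ... | yes ≡.refl = begin
      A zero j * det R (minor₀ A j)                       ≈⟨ *-congʳ (column zero) ⟩
      (α * B zero j + β * C zero j) * det R (minor₀ A j)   ≈⟨ distribʳ _ _ _ ⟩
      (α * B zero j) * det R (minor₀ A j) + (β * C zero j) * det R (minor₀ A j)
        ≈⟨ +-cong (trans (*-assoc _ _ _) (*-congˡ (*-congˡ (det-cong same-minor-B))))
                  (trans (*-assoc _ _ _) (*-congˡ (*-congˡ (det-cong same-minor-C)))) ⟩
      α * (B zero j * det R (minor₀ B j)) + β * (C zero j * det R (minor₀ C j)) ∎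
      where
      same-minor-B : ∀ i k → minor₀ A j i k ≈ minor₀ B j i k
      same-minor-B i k = A≈B (suc i) (punchIn j k) (FinP.punchInᵢ≢i j k)
      same-minor-C : ∀ i k → minor₀ A j i k ≈ minor₀ C j i k
      same-minor-C i k = A≈C (suc i) (punchIn j k) (FinP.punchInᵢ≢i j k)
    ... | no j≢c = begin
      A zero j * det R (minor₀ A j)                                   ≈⟨ *-congˡ minor-linear ⟩
      A zero j * (α * det R (minor₀ B j) + β * det R (minor₀ C j))    ≈⟨ scale-+ _ α _ β _ ⟩
      α * (A zero j * det R (minor₀ B j)) + β * (A zero j * det R (minor₀ C j))
        ≈⟨ +-cong (*-congˡ (*-congʳ (A≈B zero j j≢c))) (*-congˡ (*-congʳ (A≈C zero j j≢c))) ⟩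
      α * (B zero j * det R (minor₀ B j)) + β * (C zero j * det R (minor₀ C j)) ∎
      where
      c′ = punchOut j≢c
      off-c′ : ∀ k → k ≢ c′ → punchIn j k ≢ c
      off-c′ k k≢c′ eq = k≢c′ (FinP.punchIn-injective j k c′ (≡.trans eq (≡.sym (FinP.punchIn-punchOut j≢c))))
      minor-linear : det R (minor₀ A j) ≈ α * det R (minor₀ B j) + β * det R (minor₀ C j)
      minor-linear = det-linear c′ (minor₀ A j) (minor₀ B j) (minor₀ C j) α β
        (λ i k k≢c′ → A≈B (suc i) (punchIn j k) (off-c′ k k≢c′))
        (λ i k k≢c′ → A≈C (suc i) (punchIn j k) (off-c′ k k≢c′))
        (λ i → ≡.subst (λ z → A (suc i) z ≈ α * B (suc i) z + β * C (suc i) z)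
                       (≡.sym (FinP.punchIn-punchOut j≢c)) (column (suc i)))
    termwise : ∀ j → term A j ≈ α * term B j + β * term C j
    termwise j = trans (*-congˡ (entry×minor j)) (scale-+ _ α _ β _)

  ∑-cancelling-pair : ∀ {n} (c : Fin (suc n)) (f : Fin (suc (suc n)) → Carrier) →
    (∀ j → j ≢ inject₁ c → j ≢ suc c → f j ≈ 0#) → f (inject₁ c) + f (suc c) ≈ 0# → ∑ R f ≈ 0#
  ∑-cancelling-pair {n} zero f others pair = begin
    f zero + (f (suc zero) + ∑ R rest) ≈⟨ +-assoc _ _ _ ⟨
    (f zero + f (suc zero)) + ∑ R rest ≈⟨ +-cong pair (∑-zero rest (λ j → others (suc (suc j)) (λ ()) (λ ()))) ⟩
    0# + 0#                                       ≈⟨ +-identityˡ 0# ⟩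
    0#                                            ∎
    where
    rest : Fin n → Carrier
    rest j = f (suc (suc j))
  ∑-cancelling-pair {suc n} (suc c) f others pair =
    trans (+-cong (others zero (λ ()) (λ ()))
                  (∑-cancelling-pair c (f ∘ suc) (λ j j≢c j≢c′ → others (suc j) (j≢c ∘ FinP.suc-injective) (j≢c′ ∘ FinP.suc-injective)) pair))
          (+-identityˡ 0#)

  det-adjacent-equal : ∀ {n} (c : Fin n) (A : Mat (suc n)) → (∀ i → A i (inject₁ c) ≈ A i (suc c)) → det R A ≈ 0#
  det-adjacent-equal {suc n} c A equal = ∑-cancelling-pair c (term A) others pair
    where
    -- Deleting another column leaves two equal adjacent columns in the minor.
    others : ∀ j → j ≢ inject₁ c → j ≢ suc c → term A j ≈ 0#
    others j j≢c j≢c′ with adjacent-in-minor c j j≢c j≢c′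
    ... | c′ , p , q = trans (*-congˡ (trans (*-congˡ minor-zero) (zeroʳ _))) (zeroʳ _)
      where
      minor-zero : det R (minor₀ A j) ≈ 0#
      minor-zero = det-adjacent-equal c′ (minor₀ A j)
        (λ i → ≡.subst₂ (λ u v → A (suc i) u ≈ A (suc i) v) (≡.sym p) (≡.sym q) (equal (suc i)))
    -- The two remaining terms have equal minors and opposite signs.
    same-minor : ∀ i k → minor₀ A (inject₁ c) i k ≈ minor₀ A (suc c) i k
    same-minor i k with punchIn-adjacent c k
    ... | inj₁ eq = reflexive (≡.cong (A (suc i)) eq)
    ... | inj₂ (eq₁ , eq₂) = ≡.subst₂ (λ u v → A (suc i) u ≈ A (suc i) v) (≡.sym eq₁) (≡.sym eq₂) (sym (equal (suc i)))
    X = A zero (inject₁ c) * det R (minor₀ A (inject₁ c))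
    pair : term A (inject₁ c) + term A (suc c) ≈ 0#
    pair = begin
      sgn R (toℕ (inject₁ c)) * X + - sgn R (toℕ c) * (A zero (suc c) * det R (minor₀ A (suc c)))
        ≈⟨ +-cong (reflexive (≡.cong (λ z → sgn R z * X) (FinP.toℕ-inject₁ c)))
                  (trans (sym (-‿distribˡ-* _ _)) (-‿cong (*-congˡ (sym (*-cong (equal zero) (det-cong same-minor)))))) ⟩
      sgn R (toℕ c) * X + - (sgn R (toℕ c) * X) ≈⟨ -‿inverseʳ _ ⟩
      0# ∎

  replace₂ : ∀ {m} (A : Mat m) (p q : Fin m) (u v : Fin m → Carrier) → Mat m
  replace₂ A p q u v i j with j FinP.≟ p | j FinP.≟ q
  ... | yes _ | _     = u i
  ... | no _  | yes _ = v i
  ... | no _  | no _  = A i j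

  replace₂-p : ∀ {m} (A : Mat m) p q u v i → replace₂ A p q u v i p ≡ u i
  replace₂-p A p q u v i with p FinP.≟ p
  ... | yes _  = ≡.refl
  ... | no p≢p = ⊥-elim (p≢p ≡.refl)

  replace₂-q : ∀ {m} (A : Mat m) p q u v i → p ≢ q → replace₂ A p q u v i q ≡ v i
  replace₂-q A p q u v i p≢q with q FinP.≟ p | q FinP.≟ q
  ... | yes q≡p | _      = ⊥-elim (p≢q (≡.sym q≡p))
  ... | no _    | yes _  = ≡.refl
  ... | no _    | no q≢q = ⊥-elim (q≢q ≡.refl)

  replace₂-off-p : ∀ {m} (A : Mat m) p q u u′ v i j → j ≢ p → replace₂ A p q u v i j ≡ replace₂ A p q u′ v i j
  replace₂-off-p A p q u u′ v i j j≢p with j FinP.≟ p | j FinP.≟ q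
  ... | yes j≡p | _ = ⊥-elim (j≢p j≡p)
  ... | no _ | yes _ = ≡.refl
  ... | no _ | no _  = ≡.refl

  replace₂-off-q : ∀ {m} (A : Mat m) p q u v v′ i j → j ≢ q → replace₂ A p q u v i j ≡ replace₂ A p q u v′ i j
  replace₂-off-q A p q u v v′ i j j≢q with j FinP.≟ p | j FinP.≟ q
  ... | yes _ | _       = ≡.refl
  ... | no _  | yes j≡q = ⊥-elim (j≢q j≡q)
  ... | no _  | no _    = ≡.refl

  -- Swapping two adjacent columns changes the sign of the determinant: with
  -- D(u, v) = det of A with columns c, c+1 replaced by u, v, D is additive in
  -- each argument and D(w, w) = 0, so D(u,v) + D(v,u) = D(u+v, u+v) = 0.
  det-swap-adjacent : ∀ {n} (c : Fin (suc n)) (A : Mat (suc (suc n))) → det R (λ i j → A i (τ c j)) ≈ - det R A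
  det-swap-adjacent {n} c A = inverseʳ-unique _ _ cancel
    where
    p q : Fin (suc (suc n))
    p = inject₁ c
    q = suc c
    p≢q : p ≢ q
    p≢q = inject₁≢suc c
    D : (Fin (suc (suc n)) → Carrier) → (Fin (suc (suc n)) → Carrier) → Carrier
    D u v = det R (replace₂ A p q u v)
    u v : Fin (suc (suc n)) → Carrier
    u i = A i p
    v i = A i q
    1*-sum : ∀ {x y z} → x ≈ 1# * y + 1# * z → x ≈ y + z
    1*-sum eq = trans eq (+-cong (*-identityˡ _) (*-identityˡ _))
    additiveˡ : ∀ x y w → D (λ i → x i + y i) w ≈ D x w + D y w
    additiveˡ x y w = 1*-sum (det-linear p (replace₂ A p q (λ i → x i + y i) w) (replace₂ A p q x w) (replace₂ A p q y w) 1# 1#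
      (λ i j j≢p → reflexive (replace₂-off-p A p q _ x w i j j≢p))
      (λ i j j≢p → reflexive (replace₂-off-p A p q _ y w i j j≢p))
      (λ i → trans (reflexive (replace₂-p A p q _ w i))
                   (sym (+-cong (trans (*-identityˡ _) (reflexive (replace₂-p A p q x w i)))
                                (trans (*-identityˡ _) (reflexive (replace₂-p A p q y w i)))))))
    additiveʳ : ∀ w x y → D w (λ i → x i + y i) ≈ D w x + D w y
    additiveʳ w x y = 1*-sum (det-linear q (replace₂ A p q w (λ i → x i + y i)) (replace₂ A p q w x) (replace₂ A p q w y) 1# 1#
      (λ i j j≢q → reflexive (replace₂-off-q A p q w _ x i j j≢q))
      (λ i j j≢q → reflexive (replace₂-off-q A p q w _ y i j j≢q))
      (λ i → trans (reflexive (replace₂-q A p q w _ i p≢q))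
                   (sym (+-cong (trans (*-identityˡ _) (reflexive (replace₂-q A p q w x i p≢q)))
                                (trans (*-identityˡ _) (reflexive (replace₂-q A p q w y i p≢q)))))))
    alternating : ∀ w → D w w ≈ 0#
    alternating w = det-adjacent-equal c (replace₂ A p q w w)
      (λ i → trans (reflexive (replace₂-p A p q w w i)) (sym (reflexive (replace₂-q A p q w w i p≢q))))
    D-original : D u v ≈ det R A
    D-original = det-cong entries
      where
      entries : ∀ i j → replace₂ A p q u v i j ≈ A i j
      entries i j with j FinP.≟ p | j FinP.≟ q
      ... | yes ≡.refl | _          = refl
      ... | no _       | yes ≡.refl = refl
      ... | no _       | no _       = refl
    D-swapped : D v u ≈ det R (λ i j → A i (τ c j))
    D-swapped = det-cong entries
      where
      entries : ∀ i j → replace₂ A p q v u i j ≈ A i (τ c j)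
      entries i j with j FinP.≟ p | j FinP.≟ q
      ... | yes ≡.refl | _          = reflexive (≡.cong (A i) (≡.sym (τ-left c)))
      ... | no _       | yes ≡.refl = reflexive (≡.cong (A i) (≡.sym (τ-right c)))
      ... | no j≢p     | no j≢q     = reflexive (≡.cong (A i) (≡.sym (τ-other c j j≢p j≢q)))
    w = λ i → u i + v i
    cancel : det R A + det R (λ i j → A i (τ c j)) ≈ 0#
    cancel = begin
      det R A + det R (λ i j → A i (τ c j))   ≈⟨ +-cong D-original D-swapped ⟨
      D u v + D v u                           ≈⟨ +-cong (+-identityˡ _) (+-identityʳ _) ⟨
      (0# + D u v) + (D v u + 0#)             ≈⟨ +-cong (+-congʳ (alternating u)) (+-congˡ (alternating v)) ⟨
      (D u u + D u v) + (D v u + D v v)       ≈⟨ +-cong (additiveʳ u u v) (additiveʳ v u v) ⟨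
      D u w + D v w                           ≈⟨ additiveˡ u v w ⟨
      D w w                                   ≈⟨ alternating w ⟩
      0#                                      ∎

  det-toFront : ∀ {n} (c : Fin (suc n)) (A : Mat (suc n)) → det R (λ i j → A i (σ c j)) ≈ sgn R (toℕ c) * det R A
  det-toFront c A = go (toℕ c) c A ≡.refl
    where
    go : ∀ k {n} (c : Fin (suc n)) (A : Mat (suc n)) → toℕ c ≡ k →
         det R (λ i j → A i (σ c j)) ≈ sgn R (toℕ c) * det R A
    go k zero A _ = trans (det-cong (λ i j → reflexive (≡.cong (A i) (σ-zero j)))) (sym (*-identityˡ _))
    go (suc k) {suc n} (suc c) A c≡k = begin
      det R (λ i j → A i (σ (suc c) j))                ≈⟨ det-cong (λ i j → reflexive (≡.cong (A i) (σ-suc c j))) ⟩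
      det R (λ i j → A i (τ c (σ (inject₁ c) j)))      ≈⟨ go k (inject₁ c) (λ i j → A i (τ c j))
                                                              (≡.trans (FinP.toℕ-inject₁ c) (ℕP.suc-injective c≡k)) ⟩
      sgn R (toℕ (inject₁ c)) * det R (λ i j → A i (τ c j))
        ≈⟨ *-cong (reflexive (≡.cong (sgn R) (FinP.toℕ-inject₁ c))) (det-swap-adjacent c A) ⟩
      sgn R (toℕ c) * - det R A                        ≈⟨ trans (sym (-‿distribʳ-* _ _)) (-‿distribˡ-* _ _) ⟩
      - sgn R (toℕ c) * det R A                        ∎

  -- For size m+2 both sides are
  -- expanded twice, along the first row and the first column; the terms
  -- a_j b_i D_ij (D_ij deleting rows 0, i+1 and columns 0, j+1) match up,
  -- using the statement for sizes m+1 and m.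
  Transposable : ℕ → Set _
  Transposable n = (A : Mat n) → det R (λ i j → A j i) ≈ det R A

  transpose-step : ∀ m → Transposable (suc m) → Transposable m → Transposable (suc (suc m))
  transpose-step m transpose₁ transpose₀ A = sym (+-cong corner rest)
    where
    a b : Fin (suc m) → Carrier
    a j = A zero (suc j)
    b i = A (suc i) zero
    D : Fin (suc m) → Fin (suc m) → Carrier
    D i j = det R (λ x y → A (suc (punchIn i x)) (suc (punchIn j y)))
    corner : term A zero ≈ sgn R 0 * (A zero zero * det R (λ k l → A (suc l) (suc k)))
    corner = *-congˡ (*-congˡ (sym (transpose₁ (λ i k → A (suc i) (suc k)))))
    minor-of-a : ∀ j → det R (minor₀ A (suc j)) ≈ ∑ R (λ i → sgn R (toℕ i) * (b i * D i j))
    minor-of-a j = trans (sym (transpose₁ (minor₀ A (suc j))))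
      (∑-cong (λ i → *-congˡ {sgn R (toℕ i)} (*-congˡ {b i} (transpose₀ (λ x y → A (suc (punchIn i x)) (suc (punchIn j y)))))))
    minor-of-b : ∀ i → det R (λ k l → A (punchIn (suc i) l) (suc k)) ≈ ∑ R (λ j → sgn R (toℕ j) * (a j * D i j))
    minor-of-b i = sym (transpose₁ (λ k l → A (punchIn (suc i) l) (suc k)))
    reorder : ∀ s t x y d → s * (x * (t * (y * d))) ≈ t * (y * (s * (x * d)))
    reorder s t x y d = begin
      s * (x * (t * (y * d))) ≈⟨ *-congˡ (x∙yz≈y∙xz x t _) ⟩
      s * (t * (x * (y * d))) ≈⟨ x∙yz≈y∙xz s t _ ⟩
      t * (s * (x * (y * d))) ≈⟨ *-congˡ (*-congˡ (x∙yz≈y∙xz x y d)) ⟩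
      t * (s * (y * (x * d))) ≈⟨ *-congˡ (x∙yz≈y∙xz s y _) ⟩
      t * (y * (s * (x * d))) ∎
    distribute : ∀ s x (f : Fin (suc m) → Carrier) → - s * (x * ∑ R f) ≈ ∑ R (λ i → - (s * (x * f i)))
    distribute s x f = begin
      - s * (x * ∑ R f)           ≈⟨ *-congˡ (∑-*ˡ x f) ⟨
      - s * ∑ R (λ i → x * f i)   ≈⟨ ∑-*ˡ (- s) (λ i → x * f i) ⟨
      ∑ R (λ i → - s * (x * f i)) ≈⟨ ∑-cong (λ i → -‿distribˡ-* s (x * f i)) ⟨
      ∑ R (λ i → - (s * (x * f i))) ∎
    rest : ∑ R (λ j → term A (suc j))
         ≈ ∑ R (λ i → sgn R (toℕ (suc i)) * (b i * det R (λ k l → A (punchIn (suc i) l) (suc k))))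
    rest = begin
      ∑ R (λ j → - sgn R (toℕ j) * (a j * det R (minor₀ A (suc j))))
        ≈⟨ ∑-cong (λ j → trans (*-congˡ (*-congˡ (minor-of-a j))) (distribute (sgn R (toℕ j)) (a j) (λ i → sgn R (toℕ i) * (b i * D i j)))) ⟩
      ∑ R (λ j → ∑ R (λ i → - (sgn R (toℕ j) * (a j * (sgn R (toℕ i) * (b i * D i j))))))
        ≈⟨ ∑-swap (λ j i → - (sgn R (toℕ j) * (a j * (sgn R (toℕ i) * (b i * D i j))))) ⟩
      ∑ R (λ i → ∑ R (λ j → - (sgn R (toℕ j) * (a j * (sgn R (toℕ i) * (b i * D i j))))))
        ≈⟨ ∑-cong (λ i → ∑-cong (λ j → -‿cong (reorder (sgn R (toℕ j)) (sgn R (toℕ i)) (a j) (b i) (D i j)))) ⟩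
      ∑ R (λ i → ∑ R (λ j → - (sgn R (toℕ i) * (b i * (sgn R (toℕ j) * (a j * D i j))))))
        ≈⟨ ∑-cong (λ i → trans (*-congˡ (*-congˡ (minor-of-b i))) (distribute (sgn R (toℕ i)) (b i) (λ j → sgn R (toℕ j) * (a j * D i j)))) ⟨
      ∑ R (λ i → - sgn R (toℕ i) * (b i * det R (λ k l → A (punchIn (suc i) l) (suc k)))) ∎

  det-transpose : ∀ {n} → Transposable n
  det-transpose {zero}        A = refl
  det-transpose {suc zero}    A = refl
  det-transpose {suc (suc m)} = transpose-step m det-transpose det-transpose

  det-column₀ : ∀ {n} (A : Mat (suc n)) →
    det R A ≈ ∑ R (λ i → sgn R (toℕ i) * (A i zero * det R (λ x y → A (punchIn i x) (suc y))))
  det-column₀ A = trans (sym (det-transpose A))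
    (∑-cong (λ i → *-congˡ {sgn R (toℕ i)} (*-congˡ {A i zero} (det-transpose (λ x y → A (punchIn i x) (suc y))))))

  det-column : ∀ {n} (c : Fin (suc n)) (A : Mat (suc n)) →
    det R A ≈ sgn R (toℕ c) * ∑ R (λ i → sgn R (toℕ i) * (A i c * det R (λ x y → A (punchIn i x) (punchIn c y))))
  det-column c A = sgn-cancel (toℕ c) _ _ (trans (sym (det-toFront c A)) (det-column₀ (λ i j → A i (σ c j))))

  det-lastRow : ∀ {n} (A : Mat (suc n)) → (∀ j → j ≢ fromℕ n → A (fromℕ n) j ≈ 0#) →
    det R A ≈ A (fromℕ n) (fromℕ n) * det R (λ x y → A (inject₁ x) (inject₁ y))
  det-lastRow {n} A zeros = begin
    det R A                                  ≈⟨ det-transpose A ⟨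
    det R (λ i j → A j i)                    ≈⟨ det-column (fromℕ n) (λ i j → A j i) ⟩
    sgn R n′ * ∑ R f                         ≈⟨ *-congˡ (∑-single f (fromℕ n) others) ⟩
    sgn R n′ * (sgn R n′ * (A (fromℕ n) (fromℕ n) * det R minorᵀ))
      ≈⟨ trans (sym (*-assoc _ _ _)) (trans (*-congʳ (sgn-square n′)) (*-identityˡ _)) ⟩
    A (fromℕ n) (fromℕ n) * det R minorᵀ     ≈⟨ *-congˡ (trans (det-cong (λ x y → reflexive (≡.cong₂ A (punchIn-fromℕ y) (punchIn-fromℕ x))))
                                                                  (det-transpose (λ x y → A (inject₁ x) (inject₁ y)))) ⟩
    A (fromℕ n) (fromℕ n) * det R (λ x y → A (inject₁ x) (inject₁ y)) ∎
    where
    n′ = toℕ (fromℕ n)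
    minorᵀ : Mat n
    minorᵀ x y = A (punchIn (fromℕ n) y) (punchIn (fromℕ n) x)
    f : Fin (suc n) → Carrier
    f i = sgn R (toℕ i) * (A (fromℕ n) i * det R (λ x y → A (punchIn (fromℕ n) y) (punchIn i x)))
    others : ∀ i → i ≢ fromℕ n → f i ≈ 0#
    others i i≢n = trans (*-congˡ (trans (*-congʳ (zeros i i≢n)) (zeroˡ _))) (zeroʳ _)

  consColumn : ∀ {n} → (Fin (suc n) → Carrier) → (Fin (suc n) → Fin n → Carrier) → Mat (suc n)
  consColumn u rest i zero    = u i
  consColumn u rest i (suc j) = rest i j

  -- If the first column repeats another column, det vanishes: moving that
  -- column to the front makes columns 0 and 1 equal.
  det-repeated-column₀ : ∀ {n} (u : Fin (suc n) → Carrier) (rest : Fin (suc n) → Fin n → Carrier) (b : Fin n) →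
    (∀ i → u i ≈ rest i b) → det R (consColumn u rest) ≈ 0#
  det-repeated-column₀ {suc n} u rest b repeated = begin
    det R A                                   ≈⟨ sgn-cancel (toℕ (suc b)) _ _ (sym (det-toFront (suc b) A)) ⟩
    sgn R (toℕ (suc b)) * det R (λ i j → A i (σ (suc b) j))
      ≈⟨ *-congˡ (det-adjacent-equal zero (λ i j → A i (σ (suc b) j)) (λ i → sym (repeated i))) ⟩
    sgn R (toℕ (suc b)) * 0#                  ≈⟨ zeroʳ _ ⟩
    0#                                        ∎
    where A = consColumn u rest

  det-Σ<-column₀ : ∀ {n} N (g : ℕ → Carrier) (v : ℕ → Fin (suc n) → Carrier) (rest : Fin (suc n) → Fin n → Carrier) →
    det R (consColumn (λ i → Σ< N (λ m → g m * v m i)) rest) ≈ Σ< N (λ m → g m * det R (consColumn (v m) rest))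
  det-Σ<-column₀ zero g v rest = begin
    det R M                   ≈⟨ det-linear zero M M M 0# 0# (λ _ _ _ → refl) (λ _ _ _ → refl) (λ _ → sym zero-comb) ⟩
    0# * det R M + 0# * det R M ≈⟨ zero-comb ⟩
    0#                        ∎
    where
    M = consColumn (λ _ → 0#) rest
    zero-comb : ∀ {x y} → 0# * x + 0# * y ≈ 0#
    zero-comb = trans (+-cong (zeroˡ _) (zeroˡ _)) (+-identityˡ 0#)
  det-Σ<-column₀ {n} (suc N) g v rest = begin
    det R (consColumn (λ i → g 0 * v 0 i + Σ< N (λ m → g (suc m) * v (suc m) i)) rest)
      ≈⟨ det-linear zero _ (consColumn (v 0) rest) (consColumn (λ i → Σ< N (λ m → g (suc m) * v (suc m) i)) rest) (g 0) 1#
           off-column₀ off-column₀ (λ i → +-congˡ (sym (*-identityˡ _))) ⟩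
    g 0 * det R (consColumn (v 0) rest) + 1# * det R (consColumn (λ i → Σ< N (λ m → g (suc m) * v (suc m) i)) rest)
      ≈⟨ +-congˡ (trans (*-identityˡ _) (det-Σ<-column₀ N (g ∘ suc) (v ∘ suc) rest)) ⟩
    g 0 * det R (consColumn (v 0) rest) + Σ< N (λ m → g (suc m) * det R (consColumn (v (suc m)) rest)) ∎
    where
    off-column₀ : ∀ {u u′} (i : Fin (suc n)) (j : Fin (suc n)) → j ≢ zero → consColumn u rest i j ≈ consColumn u′ rest i j
    off-column₀ i zero    j≢0 = ⊥-elim (j≢0 ≡.refl)
    off-column₀ i (suc j) _   = refl

-- The polynomial relation behind the matrix P.  The column l of P lists the
-- coefficients expressing z^(l+n) through lower powers, valid for every root
-- z of ∏_j (z - x_j), in particular for every x_i.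
module BandMatrix {c ℓ : Level} (R : CommutativeRing c ℓ) where
  open CommutativeRing R hiding (zero)
  open import Relation.Binary.Reasoning.Setoid setoid
  open import Algebra.Properties.Ring ring using (-‿distribˡ-*)
  open import Algebra.Properties.Group +-group using (x∙y⁻¹≈ε⇒x≈y; ε⁻¹≈ε)
  open import Algebra.Properties.AbelianGroup +-abelianGroup using (⁻¹-∙-comm)
  open import Algebra.Properties.CommutativeSemigroup *-commutativeSemigroup using (x∙yz≈y∙xz)
  open import Algebra.Properties.Semiring.Sum semiring using (sum-replicate-zero; ∑-distrib-+; *-distribˡ-sum)
  open RangeSums +-commutativeMonoid

  Σ<-zero : ∀ N f → (∀ s → s ℕ.< N → f s ≈ 0#) → Σ< N f ≈ 0#
  Σ<-zero N f f≈0 = trans (Σ<-cong N f≈0) (sum-replicate-zero N)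

  Σ<-*ˡ : ∀ N a f → Σ< N (λ s → a * f s) ≈ a * Σ< N f
  Σ<-*ˡ N a f = sym (*-distribˡ-sum {N} a (f ∘ toℕ))

  Σ<-+ : ∀ N f g → Σ< N (λ s → f s + g s) ≈ Σ< N f + Σ< N g
  Σ<-+ N f g = ∑-distrib-+ {N} (f ∘ toℕ) (g ∘ toℕ)

  Σ<-neg : ∀ N f → Σ< N (λ s → - f s) ≈ - Σ< N f
  Σ<-neg zero    f = sym ε⁻¹≈ε
  Σ<-neg (suc N) f = trans (+-congˡ (Σ<-neg N (f ∘ suc))) (⁻¹-∙-comm _ _)

  pow-+ : ∀ z a b → pow R z (a ℕ.+ b) ≈ pow R z a * pow R z b
  pow-+ z zero    b = sym (*-identityˡ _)
  pow-+ z (suc a) b = trans (*-congˡ (pow-+ z a b)) (sym (*-assoc _ _ _))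

  esym-vanishes : ∀ {m} (y : Fin m → Carrier) t → m ℕ.< t → esym R t y ≈ 0#
  esym-vanishes {zero}  y (suc t) _ = refl
  esym-vanishes {suc m} y (suc t) (s≤s m<t) =
    trans (+-cong (esym-vanishes (y ∘ suc) (suc t) (ℕP.m≤n⇒m≤1+n m<t))
                  (trans (*-congˡ (esym-vanishes (y ∘ suc) t m<t)) (zeroʳ _)))
          (+-identityʳ 0#)

  -- charPoly m y z = Σ_{s ≤ m} (-1)^s σ_s(y) z^(m-s), the expansion of ∏ (z - y_j).
  charPoly : ∀ m → (Fin m → Carrier) → Carrier → Carrier
  charPoly m y z = Σ< (suc m) (λ s → sgn R s * (esym R s y * pow R z (m ∸ s)))

  charPoly-step : ∀ m (y : Fin (suc m) → Carrier) z → charPoly (suc m) y z ≈ (z - y zero) * charPoly m (y ∘ suc) z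
  charPoly-step m y z = begin
    g 0 + Σ< (suc m) (g ∘ suc)                                    ≈⟨ +-congˡ (Σ<-cong (suc m) (λ s _ → g-suc s)) ⟩
    g 0 + Σ< (suc m) (λ s → U s - y₀ * t s)                       ≈⟨ +-congˡ (Σ<-+ (suc m) U (λ s → - (y₀ * t s))) ⟩
    g 0 + (Σ< (suc m) U + Σ< (suc m) (λ s → - (y₀ * t s)))
      ≈⟨ +-congˡ (+-cong (Σ<-snoc m U) (trans (Σ<-neg (suc m) (λ s → y₀ * t s)) (-‿cong (Σ<-*ˡ (suc m) y₀ t)))) ⟩
    g 0 + ((Σ< m U + U m) - y₀ * P′)                              ≈⟨ +-congˡ (+-congʳ (trans (+-congˡ U-top) (+-identityʳ _))) ⟩
    g 0 + (Σ< m U - y₀ * P′)                                      ≈⟨ +-assoc _ _ _ ⟨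
    (g 0 + Σ< m U) - y₀ * P′
      ≈⟨ +-congʳ (+-cong z-t-head (trans (sym (Σ<-*ˡ m z (t ∘ suc))) (Σ<-cong m z-t-suc))) ⟨
    (z * t 0 + z * Σ< m (t ∘ suc)) - y₀ * P′                      ≈⟨ +-cong (distribˡ z _ _) (sym (-‿distribˡ-* y₀ P′)) ⟨
    z * P′ + - y₀ * P′                                            ≈⟨ distribʳ P′ z (- y₀) ⟨
    (z - y₀) * P′                                                 ∎
    where
    y₀ = y zero
    y′ = y ∘ suc
    P′ = charPoly m y′ z
    g t U : ℕ → Carrier
    g s = sgn R s * (esym R s y * pow R z (suc m ∸ s))
    t s = sgn R s * (esym R s y′ * pow R z (m ∸ s))
    U s = - sgn R s * (esym R (suc s) y′ * pow R z (m ∸ s))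
    -- σ_{s+1}(y) = σ_{s+1}(y′) + y₀ σ_s(y′) splits each term in two
    g-suc : ∀ s → g (suc s) ≈ U s - y₀ * t s
    g-suc s = begin
      - sgn R s * ((esym R (suc s) y′ + y₀ * esym R s y′) * pow R z (m ∸ s))
        ≈⟨ *-congˡ (distribʳ _ _ _) ⟩
      - sgn R s * (esym R (suc s) y′ * pow R z (m ∸ s) + (y₀ * esym R s y′) * pow R z (m ∸ s))
        ≈⟨ distribˡ _ _ _ ⟩
      U s + - sgn R s * ((y₀ * esym R s y′) * pow R z (m ∸ s))
        ≈⟨ +-congˡ (trans (sym (-‿distribˡ-* _ _)) (-‿cong (trans (*-congˡ (*-assoc _ _ _)) (x∙yz≈y∙xz _ _ _)))) ⟩
      U s - y₀ * t s ∎
    U-top : U m ≈ 0#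
    U-top = trans (*-congˡ (trans (*-congʳ (esym-vanishes y′ (suc m) ℕP.≤-refl)) (zeroˡ _))) (zeroʳ _)
    z-t-head : z * t 0 ≈ g 0
    z-t-head = trans (x∙yz≈y∙xz _ _ _) (*-congˡ (x∙yz≈y∙xz _ _ _))
    m∸s : ∀ m s → s ℕ.< m → m ∸ s ≡ suc (m ∸ suc s)
    m∸s (suc m) zero    _         = ≡.refl
    m∸s (suc m) (suc s) (s≤s s<m) = m∸s m s s<m
    z-t-suc : ∀ s → s ℕ.< m → z * t (suc s) ≈ U s
    z-t-suc s s<m = trans (x∙yz≈y∙xz _ _ _)
      (*-congˡ (trans (x∙yz≈y∙xz _ _ _) (*-congˡ (sym (reflexive (≡.cong (pow R z) (m∸s m s s<m)))))))

  charPoly-root : ∀ m (y : Fin m → Carrier) (i : Fin m) → charPoly m y (y i) ≈ 0#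
  charPoly-root (suc m) y zero    = trans (charPoly-step m y (y zero)) (trans (*-congʳ (-‿inverseʳ _)) (zeroˡ _))
  charPoly-root (suc m) y (suc i) = trans (charPoly-step m y (y (suc i))) (trans (*-congˡ (charPoly-root m (y ∘ suc) i)) (zeroʳ _))

  power-relation : ∀ {n} (x : Fin n → Carrier) (z : Carrier) → charPoly n x z ≈ 0# →
                   pow R z n ≈ Σ< n (λ t → pcoef R x (suc t) * pow R z t)
  power-relation {n} x z root = x∙y⁻¹≈ε⇒x≈y _ _ (begin
    pow R z n - Σ< n f                                   ≈⟨ +-cong (sym (trans (*-identityˡ _) (*-identityˡ _))) (-‿cong (sym (Σ<-reverse n f))) ⟩
    1# * (1# * pow R z n) - Σ< n (λ s → f (n ∸ suc s))   ≈⟨ +-congˡ (sym (Σ<-neg n (λ s → f (n ∸ suc s)))) ⟩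
    1# * (1# * pow R z n) + Σ< n (λ s → - f (n ∸ suc s)) ≈⟨ +-congˡ (Σ<-cong n (λ s s<n → sym (coefficient s s<n))) ⟩
    charPoly n x z                                       ≈⟨ root ⟩
    0#                                                   ∎)
    where
    f : ℕ → Carrier
    f t = pcoef R x (suc t) * pow R z t
    n∸[n∸s] : ∀ n s → s ℕ.< n → n ∸ suc (n ∸ suc s) ≡ s
    n∸[n∸s] (suc n) s (s≤s s≤n) = ℕP.m∸[m∸n]≡n s≤n
    coefficient : ∀ s → s ℕ.< n → sgn R (suc s) * (esym R (suc s) x * pow R z (n ∸ suc s)) ≈ - f (n ∸ suc s)
    coefficient s s<n = begin
      - sgn R s * (esym R (suc s) x * pow R z (n ∸ suc s))     ≈⟨ trans (sym (-‿distribˡ-* _ _)) (-‿cong (sym (*-assoc _ _ _))) ⟩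
      - ((sgn R s * esym R (suc s) x) * pow R z (n ∸ suc s))   ≈⟨ -‿cong (*-congʳ (reflexive (≡.cong (λ u → sgn R u * esym R (suc u) x) (≡.sym (n∸[n∸s] n s s<n))))) ⟩
      - f (n ∸ suc s)                                          ∎

  P-above : ∀ {n} (x : Fin n → Carrier) i j → i ℕ.< j → Pmat R x i j ≡ 0#
  P-above x i j i<j rewrite <ᵇ-true i<j = ≡.refl

  P-band : ∀ {n} (x : Fin n → Carrier) i j → j ℕ.≤ i → i ∸ j ℕ.< n → Pmat R x i j ≡ pcoef R x (suc (i ∸ j))
  P-band x i j j≤i i∸j<n rewrite <ᵇ-false j≤i | <ᵇ-true i∸j<n = ≡.refl

  P-edge : ∀ {n} (x : Fin n → Carrier) i j → j ℕ.≤ i → i ∸ j ≡ n → Pmat R x i j ≡ - 1#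
  P-edge {n} x i j j≤i i∸j≡n rewrite <ᵇ-false j≤i | i∸j≡n | <ᵇ-false (ℕP.≤-refl {n}) | ≡ᵇ-refl n = ≡.refl

  P-below : ∀ {n} (x : Fin n → Carrier) i j → j ℕ.≤ i → n ℕ.< i ∸ j → Pmat R x i j ≡ 0#
  P-below {n} x i j j≤i n<i∸j
    rewrite <ᵇ-false j≤i | <ᵇ-false (ℕP.<⇒≤ n<i∸j) | ≡ᵇ-false (ℕP.<⇒≢ n<i∸j ∘ ≡.sym) = ≡.refl

  P-column : ∀ {n} (x : Fin n → Carrier) (l : ℕ) (z : Carrier) → charPoly n x z ≈ 0# →
             pow R z (l ℕ.+ n) ≈ Σ< (l ℕ.+ n) (λ m → Pmat R x m l * pow R z m)
  P-column {n} x l z root = sym (begin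
    Σ< (l ℕ.+ n) H                                                     ≈⟨ Σ<-split l n H ⟩
    Σ< l H + Σ< n (λ t → H (l ℕ.+ t))
      ≈⟨ +-cong (Σ<-zero l H (λ s s<l → trans (*-congʳ (reflexive (P-above x s l s<l))) (zeroˡ _))) (Σ<-cong n band) ⟩
    0# + Σ< n (λ t → pow R z l * (pcoef R x (suc t) * pow R z t))     ≈⟨ trans (+-identityˡ _) (Σ<-*ˡ n (pow R z l) (λ t → pcoef R x (suc t) * pow R z t)) ⟩
    pow R z l * Σ< n (λ t → pcoef R x (suc t) * pow R z t)            ≈⟨ *-congˡ (power-relation x z root) ⟨
    pow R z l * pow R z n                                              ≈⟨ pow-+ z l n ⟨
    pow R z (l ℕ.+ n)                                                  ∎)
    where
    H : ℕ → Carrier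
    H m = Pmat R x m l * pow R z m
    band : ∀ t → t ℕ.< n → H (l ℕ.+ t) ≈ pow R z l * (pcoef R x (suc t) * pow R z t)
    band t t<n = begin
      Pmat R x (l ℕ.+ t) l * pow R z (l ℕ.+ t)
        ≈⟨ *-cong (reflexive (≡.trans (P-band x (l ℕ.+ t) l (ℕP.m≤m+n l t) (≡.subst (ℕ._< n) (≡.sym (ℕP.m+n∸m≡n l t)) t<n))
                                     (≡.cong (λ u → pcoef R x (suc u)) (ℕP.m+n∸m≡n l t))))
                  (pow-+ z l t) ⟩
      pcoef R x (suc t) * (pow R z l * pow R z t)   ≈⟨ x∙yz≈y∙xz _ _ _ ⟩
      pow R z l * (pcoef R x (suc t) * pow R z t)   ∎

module Reduction {c ℓ : Level} (R : CommutativeRing c ℓ) (k : ℕ) (x : Fin (suc k) → CommutativeRing.Carrier R) where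
  open CommutativeRing R hiding (zero)
  open import Relation.Binary.Reasoning.Setoid setoid
  open import Algebra.Properties.Ring ring using (-‿distribˡ-*; -1*x≈-x)
  open import Algebra.Properties.CommutativeSemigroup *-commutativeSemigroup using (x∙yz≈y∙xz)
  open Determinants R
  open BandMatrix R

  n : ℕ
  n = suc k

  Q : ∀ {l} → (Fin l → ℕ) → Mat l
  Q κ i j = Pmat R x (κ i) (toℕ j)

  M : (Fin n → ℕ) → Mat n
  M ε i j = pow R (x i) (ε j)

  V : Carrier
  V = det R (M toℕ)

  Tn : ℕ
  Tn = Σℕ (λ (b : Fin n) → toℕ b)

  Reduces : ℕ → Set _
  Reduces l = (κ : Fin l → ℕ) (ε : Fin n → ℕ) → Increasing κ → Increasing ε → Partition (l ℕ.+ n) κ ε →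
              det R (Q κ) * V ≈ sgn R (Tn ℕ.+ Σℕ ε ℕ.+ l) * det R (M ε)

  -- No rows: ε must be 0, 1, …, n-1.
  reduces-0 : Reduces 0
  reduces-0 κ ε incκ incε p = begin
    1# * V                               ≈⟨ *-identityˡ V ⟩
    V                                    ≈⟨ det-cong (λ i j → reflexive (≡.cong (pow R (x i)) (ε≡id j))) ⟨
    det R (M ε)                          ≈⟨ *-identityˡ _ ⟨
    1# * det R (M ε)                     ≈⟨ *-congʳ (trans (reflexive (≡.cong (sgn R) exponent)) (trans (sgn-+ Tn Tn) (sgn-square Tn))) ⟨
    sgn R (Tn ℕ.+ Σℕ ε ℕ.+ 0) * det R (M ε) ∎
    where
    ε≡id : ∀ b → ε b ≡ toℕ b
    ε≡id = increasing-below-length ε incε (Partition.ε< p)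
    exponent : Tn ℕ.+ Σℕ ε ℕ.+ 0 ≡ Tn ℕ.+ Tn
    exponent = ≡.trans (ℕP.+-identityʳ _) (≡.cong (Tn ℕ.+_) (Σℕ-cong {n} ε≡id))

  -- The top value is the last row of Q κ: that row is (0, …, 0, -1).
  reduces-top-row : ∀ l → Reduces l → (κ : Fin (suc l) → ℕ) (ε : Fin n → ℕ) → Increasing κ → Increasing ε →
    Partition (suc l ℕ.+ n) κ ε → κ (fromℕ l) ≡ l ℕ.+ n →
    det R (Q κ) * V ≈ sgn R (Tn ℕ.+ Σℕ ε ℕ.+ suc l) * det R (M ε)
  reduces-top-row l reduces κ ε incκ incε p top = begin
    det R (Q κ) * V
      ≈⟨ *-congʳ (det-lastRow (Q κ) last-row-zero) ⟩
    (Q κ (fromℕ l) (fromℕ l) * det R (λ a b → Q κ (inject₁ a) (inject₁ b))) * V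
      ≈⟨ *-congʳ (*-cong corner (det-cong (λ a b → reflexive (≡.cong (Pmat R x (κ (inject₁ a))) (FinP.toℕ-inject₁ b))))) ⟩
    (- 1# * det R (Q (κ ∘ inject₁))) * V         ≈⟨ *-assoc _ _ _ ⟩
    - 1# * (det R (Q (κ ∘ inject₁)) * V)         ≈⟨ *-congˡ (reduces (κ ∘ inject₁) ε (Increasing-inject₁ incκ) incε (partition-dropLast p incκ top)) ⟩
    - 1# * (sgn R (Tn ℕ.+ Σℕ ε ℕ.+ l) * det R (M ε)) ≈⟨ trans (-1*x≈-x _) (-‿distribˡ-* _ _) ⟩
    - sgn R (Tn ℕ.+ Σℕ ε ℕ.+ l) * det R (M ε)    ≡⟨ ≡.cong (λ e → sgn R e * det R (M ε)) (ℕP.+-suc (Tn ℕ.+ Σℕ ε) l) ⟨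
    sgn R (Tn ℕ.+ Σℕ ε ℕ.+ suc l) * det R (M ε)  ∎
    where
    N = l ℕ.+ n
    last-row-zero : ∀ j → j ≢ fromℕ l → Q κ (fromℕ l) j ≈ 0#
    last-row-zero j j≢l = reflexive (≡.trans (≡.cong (λ z → Pmat R x z (toℕ j)) top) (P-below x N (toℕ j) j≤N far))
      where
      j<l : toℕ j ℕ.< l
      j<l = ≡.subst (toℕ j ℕ.<_) (FinP.toℕ-fromℕ l) (<-fromℕ j j≢l)
      j≤N : toℕ j ℕ.≤ N
      j≤N = ℕP.≤-trans (ℕP.<⇒≤ j<l) (ℕP.m≤m+n l n)
      far : n ℕ.< N ∸ toℕ j
      far = ≡.subst (n ℕ.<_) (≡.sym (ℕP.+-∸-comm n (ℕP.<⇒≤ j<l)))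
              (≡.subst (n ℕ.<_) (ℕP.+-comm n (l ∸ toℕ j)) (ℕP.m<m+n n (ℕP.m<n⇒0<n∸m j<l)))
    corner : Q κ (fromℕ l) (fromℕ l) ≈ - 1#
    corner = reflexive (≡.trans (≡.cong₂ (Pmat R x) top (FinP.toℕ-fromℕ l)) (P-edge x N l (ℕP.m≤m+n l n) (ℕP.m+n∸m≡n l n)))

  gather-signs : ∀ s t a b → sgn R s * (a * (sgn R t * b)) ≈ sgn R (s ℕ.+ t) * (a * b)
  gather-signs s t a b = begin
    sgn R s * (a * (sgn R t * b))     ≈⟨ *-congˡ (x∙yz≈y∙xz a (sgn R t) b) ⟩
    sgn R s * (sgn R t * (a * b))     ≈⟨ *-assoc _ _ _ ⟨
    (sgn R s * sgn R t) * (a * b)     ≈⟨ *-congʳ (sgn-+ s t) ⟨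
    sgn R (s ℕ.+ t) * (a * b)         ∎

  -- The top value is the last exponent of ε.  Both det Q κ · V and M ε expand
  -- into sums over the rows a of κ, of P_{κ a, l} · M(ε with κ a in place of N).
  module TopExponent (l : ℕ) (reduces : Reduces l) (κ : Fin (suc l) → ℕ) (ε : Fin n → ℕ)
                     (incκ : Increasing κ) (incε : Increasing ε) (p : Partition (suc l ℕ.+ n) κ ε)
                     (top : ε (fromℕ k) ≡ l ℕ.+ n) where
    N : ℕ
    N = l ℕ.+ n

    coeff : ℕ → Carrier
    coeff m = Pmat R x m l

    f : Fin k → ℕ
    f = ε ∘ inject₁

    pos : Fin (suc l) → Fin n
    pos a = position f (κ a)

    ε′ : Fin (suc l) → Fin n → ℕ
    ε′ a = insert (pos a) f (κ a)

    moved : ∀ a → MovedRow N κ f a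
    moved = move-row κ ε incκ incε p top

    Mᵃ : Fin (suc l) → Carrier
    Mᵃ a = det R (M (ε′ a))

    contribution : Fin (suc l) → Carrier
    contribution a = coeff (κ a) * (sgn R (toℕ (pos a)) * Mᵃ a)

    -- Expansion of det Q κ along its last column; the minor of row a is
    -- Q (κ without a), to which the reduction for l applies.
    Q-expansion : det R (Q κ) * V ≈ ∑ R (λ a → sgn R (l ℕ.+ (toℕ a ℕ.+ (Tn ℕ.+ Σℕ (ε′ a) ℕ.+ l))) * (coeff (κ a) * Mᵃ a))
    Q-expansion = begin
      det R (Q κ) * V                                   ≈⟨ *-congʳ (det-column (fromℕ l) (Q κ)) ⟩
      (sgn R (toℕ (fromℕ l)) * ∑ R term-l) * V          ≈⟨ *-assoc _ _ _ ⟩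
      sgn R (toℕ (fromℕ l)) * (∑ R term-l * V)          ≈⟨ *-cong (reflexive (≡.cong (sgn R) (FinP.toℕ-fromℕ l))) (trans (∑-*ʳ term-l V) (∑-cong reduced)) ⟩
      sgn R l * ∑ R reduced-term                        ≈⟨ ∑-*ˡ (sgn R l) reduced-term ⟨
      ∑ R (λ a → sgn R l * reduced-term a)
        ≈⟨ ∑-cong (λ a → trans (*-congˡ (gather-signs (toℕ a) (e a) (coeff (κ a)) (Mᵃ a)))
                               (trans (sym (*-assoc _ _ _)) (*-congʳ (sym (sgn-+ l (toℕ a ℕ.+ e a)))))) ⟩
      ∑ R (λ a → sgn R (l ℕ.+ (toℕ a ℕ.+ e a)) * (coeff (κ a) * Mᵃ a)) ∎
      where
      e : Fin (suc l) → ℕ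
      e a = Tn ℕ.+ Σℕ (ε′ a) ℕ.+ l
      reduced-term : Fin (suc l) → Carrier
      reduced-term a = sgn R (toℕ a) * (coeff (κ a) * (sgn R (e a) * Mᵃ a))
      term-l : Fin (suc l) → Carrier
      term-l a = sgn R (toℕ a) * (Q κ a (fromℕ l) * det R (λ i j → Q κ (punchIn a i) (punchIn (fromℕ l) j)))
      minor : ∀ a → det R (λ i j → Q κ (punchIn a i) (punchIn (fromℕ l) j)) ≈ det R (Q (κ ∘ punchIn a))
      minor a = det-cong (λ i j → reflexive (≡.cong (Pmat R x (κ (punchIn a i)))
                                               (≡.trans (≡.cong toℕ (punchIn-fromℕ j)) (FinP.toℕ-inject₁ j))))
      reduced : ∀ a → term-l a * V ≈ reduced-term a
      reduced a = begin
        term-l a * V                                               ≈⟨ trans (*-assoc _ _ _) (*-congˡ (*-assoc _ _ _)) ⟩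
        sgn R (toℕ a) * (Q κ a (fromℕ l) * (det R (λ i j → Q κ (punchIn a i) (punchIn (fromℕ l) j)) * V))
          ≈⟨ *-congˡ (*-cong (reflexive (≡.cong (Pmat R x (κ a)) (FinP.toℕ-fromℕ l))) (*-congʳ (minor a))) ⟩
        sgn R (toℕ a) * (coeff (κ a) * (det R (Q (κ ∘ punchIn a)) * V))
          ≈⟨ *-congˡ (*-congˡ (reduces (κ ∘ punchIn a) (ε′ a) (MovedRow.rows-increasing (moved a))
                                       (MovedRow.exponents-increasing (moved a)) (MovedRow.partition (moved a)))) ⟩
        sgn R (toℕ a) * (coeff (κ a) * (sgn R (e a) * Mᵃ a))      ∎

    -- Expansion of M ε: move the top column x_i^N to the front and write
    -- x_i^N = Σ_{m<N} P_{m,l} x_i^m.  By multilinearity the terms with m an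
    -- exponent of f repeat a column and vanish; m = κ a gives M(ε′ a) up to
    -- moving column pos a to the front.
    M-expansion : det R (M ε) ≈ sgn R k * ∑ R contribution
    M-expansion = begin
      det R (M ε)                                              ≈⟨ sgn-cancel (toℕ (fromℕ k)) _ _ (sym (det-toFront (fromℕ k) (M ε))) ⟩
      sgn R (toℕ (fromℕ k)) * det R (λ i j → M ε i (σ (fromℕ k) j))
        ≈⟨ *-cong (reflexive (≡.cong (sgn R) (FinP.toℕ-fromℕ k))) (det-cong top-in-front) ⟩
      sgn R k * det R (consColumn (λ i → Σ< N (λ m → coeff m * v m i)) rest)
        ≈⟨ *-congˡ (begin
          det R (consColumn (λ i → Σ< N (λ m → coeff m * v m i)) rest)   ≈⟨ det-Σ<-column₀ N coeff v rest ⟩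
          Σ< N h                                                         ≈⟨ Σ<-partition N κ f incκ (Increasing-inject₁ incε) p′ h ⟩
          sum (h ∘ κ) + sum (h ∘ f)                                      ≡⟨ ≡.cong₂ _+_ (∑≡sum (h ∘ κ)) (∑≡sum (h ∘ f)) ⟨
          ∑ R (h ∘ κ) + ∑ R (h ∘ f)                                      ≈⟨ +-congˡ (∑-zero (h ∘ f) repeated) ⟩
          ∑ R (h ∘ κ) + 0#                                               ≈⟨ +-identityʳ _ ⟩
          ∑ R (h ∘ κ)                                                    ≈⟨ ∑-cong row-term ⟩
          ∑ R contribution       ∎) ⟩
      sgn R k * ∑ R contribution ∎
      where
      p′ : Partition N κ f
      p′ = Partition-swap (partition-dropLast (Partition-swap p) incε top)
      v : ℕ → Fin n → Carrier
      v m i = pow R (x i) m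
      rest : Fin n → Fin k → Carrier
      rest i j = pow R (x i) (f j)
      h : ℕ → Carrier
      h m = coeff m * det R (consColumn (v m) rest)
      top-in-front : ∀ i j → M ε i (σ (fromℕ k) j) ≈ consColumn (λ i → Σ< N (λ m → coeff m * v m i)) rest i j
      top-in-front i zero    = trans (reflexive (≡.cong (pow R (x i)) top)) (P-column x l (x i) (charPoly-root n x i))
      top-in-front i (suc j) = reflexive (≡.cong (λ z → pow R (x i) (ε z)) (punchIn-fromℕ j))
      repeated : ∀ b → h (f b) ≈ 0#
      repeated b = trans (*-congˡ (det-repeated-column₀ (v (f b)) rest b (λ _ → refl))) (zeroʳ _)
      row-term : ∀ a → h (κ a) ≈ contribution a
      row-term a = *-congˡ (trans (det-cong columns) (det-toFront (pos a) (M (ε′ a))))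
        where
        columns : ∀ i j → consColumn (v (κ a)) rest i j ≈ M (ε′ a) i (σ (pos a) j)
        columns i zero    = reflexive (≡.cong (pow R (x i)) (≡.sym (insert-at (pos a) f (κ a))))
        columns i (suc j) = reflexive (≡.cong (pow R (x i)) (≡.sym (insert-punchIn (pos a) f (κ a) j)))

    parity : ∀ a → l ℕ.+ (toℕ a ℕ.+ (Tn ℕ.+ Σℕ (ε′ a) ℕ.+ l)) ℕ.+ (n ℕ.+ n)
                 ≡ (Tn ℕ.+ Σℕ ε ℕ.+ suc l) ℕ.+ (k ℕ.+ toℕ (pos a)) ℕ.+ (toℕ a ℕ.+ toℕ a)
    parity a = ≡.trans (≡.cong (λ s → l ℕ.+ (toℕ a ℕ.+ (Tn ℕ.+ s ℕ.+ l)) ℕ.+ (n ℕ.+ n)) Σε′)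
                (≡.trans (arithmetic l k (toℕ a) Tn (toℕ (pos a)) (Σℕ f))
                         (≡.cong (λ s → (Tn ℕ.+ s ℕ.+ suc l) ℕ.+ (k ℕ.+ toℕ (pos a)) ℕ.+ (toℕ a ℕ.+ toℕ a)) (≡.sym Σε)))
      where
      Σε′ : Σℕ (ε′ a) ≡ (toℕ a ℕ.+ toℕ (pos a)) ℕ.+ Σℕ f
      Σε′ = ≡.trans (Σℕ-insert (pos a) f (κ a)) (≡.cong (ℕ._+ Σℕ f) (≡.sym (MovedRow.rank (moved a))))
      Σε : Σℕ ε ≡ Σℕ f ℕ.+ N
      Σε = ≡.trans (Σℕ-init-last ε) (≡.cong (Σℕ f ℕ.+_) top)
      arithmetic : ∀ l k I T t F → l ℕ.+ (I ℕ.+ (T ℕ.+ ((I ℕ.+ t) ℕ.+ F) ℕ.+ l)) ℕ.+ (suc k ℕ.+ suc k)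
                   ≡ (T ℕ.+ (F ℕ.+ (l ℕ.+ suc k)) ℕ.+ suc l) ℕ.+ (k ℕ.+ t) ℕ.+ (I ℕ.+ I)
      arithmetic = solve-∀

    reduces-top-exponent : det R (Q κ) * V ≈ sgn R (Tn ℕ.+ Σℕ ε ℕ.+ suc l) * det R (M ε)
    reduces-top-exponent = begin
      det R (Q κ) * V                                                   ≈⟨ Q-expansion ⟩
      ∑ R (λ a → sgn R (l ℕ.+ (toℕ a ℕ.+ (Tn ℕ.+ Σℕ (ε′ a) ℕ.+ l))) * (coeff (κ a) * Mᵃ a))
        ≈⟨ ∑-cong (λ a → *-congʳ {coeff (κ a) * Mᵃ a} (sgn-parity _ (X ℕ.+ (k ℕ.+ toℕ (pos a))) n (toℕ a) (parity a))) ⟩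
      ∑ R (λ a → sgn R (X ℕ.+ (k ℕ.+ toℕ (pos a))) * (coeff (κ a) * Mᵃ a))
        ≈⟨ ∑-cong split-sign ⟩
      ∑ R (λ a → sgn R X * (sgn R k * contribution a))
        ≈⟨ trans (∑-*ˡ (sgn R X) (λ a → sgn R k * contribution a)) (*-congˡ (∑-*ˡ (sgn R k) contribution)) ⟩
      sgn R X * (sgn R k * ∑ R contribution)
        ≈⟨ *-congˡ M-expansion ⟨
      sgn R X * det R (M ε)                                             ∎
      where
      X = Tn ℕ.+ Σℕ ε ℕ.+ suc l
      split-sign : ∀ a → sgn R (X ℕ.+ (k ℕ.+ toℕ (pos a))) * (coeff (κ a) * Mᵃ a)
                       ≈ sgn R X * (sgn R k * contribution a)
      split-sign a = begin
        sgn R (X ℕ.+ (k ℕ.+ toℕ (pos a))) * (coeff (κ a) * Mᵃ a)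
          ≈⟨ *-congʳ (trans (sgn-+ X _) (*-congˡ (sgn-+ k _))) ⟩
        (sgn R X * (sgn R k * sgn R (toℕ (pos a)))) * (coeff (κ a) * Mᵃ a)
          ≈⟨ trans (*-assoc _ _ _) (*-congˡ (*-assoc _ _ _)) ⟩
        sgn R X * (sgn R k * (sgn R (toℕ (pos a)) * (coeff (κ a) * Mᵃ a)))
          ≈⟨ *-congˡ (*-congˡ (x∙yz≈y∙xz _ _ _)) ⟩
        sgn R X * (sgn R k * contribution a) ∎

  reduction : ∀ l → Reduces l
  reduction zero = reduces-0
  reduction (suc l) κ ε incκ incε p with κ (fromℕ l) ℕP.≟ l ℕ.+ n
  ... | yes top = reduces-top-row l (reduction l) κ ε incκ incε p top
  ... | no κ≢top with Partition.cover p (l ℕ.+ n) ℕP.≤-refl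
  ...   | inj₁ (a , κa≡top) = ⊥-elim (κ≢top (partition-max-last p incκ a κa≡top))
  ...   | inj₂ (b , εb≡top) = TopExponent.reduces-top-exponent l (reduction l) κ ε incκ incε p
                                (partition-max-last (Partition-swap p) incε b εb≡top)

record Enumerates (p : ℕ → Bool) (E : ℕ) (xs : List ℕ) : Set where
  field
    member   : ∀ i → i ℕ.< length xs → nth xs i ℕ.< E × p (nth xs i) ≡ true
    sorted   : ∀ i j → i ℕ.< j → j ℕ.< length xs → nth xs i ℕ.< nth xs j
    complete : ∀ v → v ℕ.< E → p v ≡ true → ∃ λ i → i ℕ.< length xs × nth xs i ≡ v

<-suc-cases : ∀ {i n} → i ℕ.< suc n → i ℕ.< n ⊎ i ≡ n
<-suc-cases (s≤s i≤n) = ℕP.m≤n⇒m<n∨m≡n i≤n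

nth-++ˡ : ∀ xs ys i → i ℕ.< length xs → nth (xs ++ ys) i ≡ nth xs i
nth-++ˡ (x ∷ xs) ys zero    _         = ≡.refl
nth-++ˡ (x ∷ xs) ys (suc i) (s≤s i<n) = nth-++ˡ xs ys i i<n

nth-snoc : ∀ xs y → nth (xs ++ y ∷ []) (length xs) ≡ y
nth-snoc []       y = ≡.refl
nth-snoc (x ∷ xs) y = nth-snoc xs y

length-snoc : ∀ (xs : List ℕ) y → length (xs ++ y ∷ []) ≡ suc (length xs)
length-snoc xs y = ≡.trans (ListP.length-++-sucʳ xs y []) (≡.cong (suc ∘ length) (ListP.++-identityʳ xs))

enumerates-skip : ∀ {p E xs} → Enumerates p E xs → p E ≡ false → Enumerates p (suc E) xs
enumerates-skip {p} {E} {xs} en pE = record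
  { member = λ i i< → ℕP.m<n⇒m<1+n (proj₁ (member i i<)) , proj₂ (member i i<)
  ; sorted = sorted
  ; complete = complete′ }
  where
  open Enumerates en
  complete′ : ∀ v → v ℕ.< suc E → p v ≡ true → ∃ λ i → i ℕ.< length xs × nth xs i ≡ v
  complete′ v v<E+1 pv with <-suc-cases v<E+1
  ... | inj₁ v<E     = complete v v<E pv
  ... | inj₂ ≡.refl with () ← ≡.trans (≡.sym pv) pE

enumerates-snoc : ∀ {p E xs} → Enumerates p E xs → p E ≡ true → Enumerates p (suc E) (xs ++ E ∷ [])
enumerates-snoc {p} {E} {xs} en pE = record { member = member′ ; sorted = sorted′ ; complete = complete′ }
  where
  open Enumerates en
  ys = xs ++ E ∷ []
  index-cases : ∀ {i} → i ℕ.< length ys → i ℕ.< length xs ⊎ i ≡ length xs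
  index-cases i< = <-suc-cases (≡.subst (_ ℕ.<_) (length-snoc xs E) i<)
  member′ : ∀ i → i ℕ.< length ys → nth ys i ℕ.< suc E × p (nth ys i) ≡ true
  member′ i i< with index-cases i<
  ... | inj₁ i<n rewrite nth-++ˡ xs (E ∷ []) i i<n = ℕP.m<n⇒m<1+n (proj₁ (member i i<n)) , proj₂ (member i i<n)
  ... | inj₂ ≡.refl rewrite nth-snoc xs E = ℕP.≤-refl , pE
  sorted′ : ∀ i j → i ℕ.< j → j ℕ.< length ys → nth ys i ℕ.< nth ys j
  sorted′ i j i<j j< with index-cases j<
  ... | inj₁ j<n rewrite nth-++ˡ xs (E ∷ []) j j<n | nth-++ˡ xs (E ∷ []) i (ℕP.<-trans i<j j<n) = sorted i j i<j j<n
  ... | inj₂ ≡.refl rewrite nth-snoc xs E | nth-++ˡ xs (E ∷ []) i i<j = proj₁ (member i i<j)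
  complete′ : ∀ v → v ℕ.< suc E → p v ≡ true → ∃ λ i → i ℕ.< length ys × nth ys i ≡ v
  complete′ v v<E+1 pv with <-suc-cases v<E+1
  ... | inj₂ ≡.refl = length xs , ≡.subst (length xs ℕ.<_) (≡.sym (length-snoc xs E)) ℕP.≤-refl , nth-snoc xs E
  ... | inj₁ v<E with complete v v<E pv
  ...   | i , i<n , eq = i , ≡.subst (i ℕ.<_) (≡.sym (length-snoc xs E)) (ℕP.m<n⇒m<1+n i<n) , ≡.trans (nth-++ˡ xs (E ∷ []) i i<n) eq

filter-snoc : ∀ (p : ℕ → Bool) E → filterᵇ p (upTo (suc E)) ≡ filterᵇ p (upTo E) ++ filterᵇ p (E ∷ [])
filter-snoc p E = ≡.trans (≡.cong (filterᵇ p) (≡.sym (ListP.upTo-∷ʳ E))) (ListP.filter-++ (T? ∘ p) (upTo E) (E ∷ []))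

filter-upTo-enumerates : ∀ p E → Enumerates p E (filterᵇ p (upTo E))
filter-upTo-enumerates p zero = record { member = λ _ () ; sorted = λ _ _ _ () ; complete = λ _ () }
filter-upTo-enumerates p (suc E) with p E in pE
... | true  = ≡.subst (Enumerates p (suc E)) (≡.sym (≡.trans (filter-snoc p E) (≡.cong (filterᵇ p (upTo E) ++_) accept)))
                      (enumerates-snoc (filter-upTo-enumerates p E) pE)
  where
  accept : filterᵇ p (E ∷ []) ≡ E ∷ []
  accept = ListP.filter-accept (T? ∘ p) (Equivalence.from BoolP.T-≡ pE)
... | false = ≡.subst (Enumerates p (suc E)) (≡.sym (≡.trans (filter-snoc p E) (≡.trans (≡.cong (filterᵇ p (upTo E) ++_) reject) (ListP.++-identityʳ _))))
                      (enumerates-skip (filter-upTo-enumerates p E) pE)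
  where
  reject : filterᵇ p (E ∷ []) ≡ []
  reject = ListP.filter-reject (T? ∘ p) (λ t → ≡.subst T pE t)

deleted⇒exponent : ∀ {k} (e : Fin (suc k) → ℕ) v → deleted e v ≡ true → ∃ λ (b : Fin k) → e (inject₁ b) ≡ v
deleted⇒exponent {suc k} e v del with e zero ≡ᵇ v in eq
... | true  = zero , ℕP.≡ᵇ⇒≡ (e zero) v (Equivalence.from BoolP.T-≡ eq)
... | false with deleted⇒exponent (e ∘ suc) v del
...   | b , eb≡v = suc b , eb≡v

exponent⇒deleted : ∀ {k} (e : Fin (suc k) → ℕ) v (b : Fin k) → e (inject₁ b) ≡ v → deleted e v ≡ true
exponent⇒deleted {suc k} e v zero ≡.refl rewrite ≡ᵇ-refl (e zero) = ≡.refl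
exponent⇒deleted {suc k} e v (suc b) eb≡v =
  ≡.trans (≡.cong ((e zero ≡ᵇ v) ∨_) (exponent⇒deleted (e ∘ suc) v b eb≡v)) (BoolP.∨-zeroʳ _)

Σℕ-ones : ∀ l → Σℕ (λ (_ : Fin l) → 1) ≡ l
Σℕ-ones zero    = ≡.refl
Σℕ-ones (suc l) = ≡.cong suc (Σℕ-ones l)

partition-size : ∀ {N l m} (κ : Fin l → ℕ) (ε : Fin m → ℕ) → Increasing κ → Increasing ε → Partition N κ ε → l ℕ.+ m ≡ N
partition-size {N} {l} {m} κ ε incκ incε p = begin
  l ℕ.+ m                                         ≡⟨ ≡.cong₂ ℕ._+_ (Σℕ-ones l) (Σℕ-ones m) ⟨
  Σℕ (λ (_ : Fin l) → 1) ℕ.+ Σℕ (λ (_ : Fin m) → 1) ≡⟨ Σℕ<-partition N κ ε incκ incε p (λ _ → 1) ⟨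
  Σℕ< N (λ _ → 1)                                 ≡⟨ Σℕ-ones N ⟩
  N                                               ∎
  where open ≡.≡-Reasoning

module KeptRows {k : ℕ} (e : Fin (suc k) → ℕ) (inc : Increasing e) where
  E : ℕ
  E = e (fromℕ k)

  L : List ℕ
  L = keptRows e

  enumerates : Enumerates (λ v → not (deleted e v)) E L
  enumerates = filter-upTo-enumerates (λ v → not (deleted e v)) E

  open Enumerates enumerates

  rows : ∀ {l} → Fin l → ℕ
  rows i = nth L (toℕ i)

  not-deleted : ∀ i → i ℕ.< length L → deleted e (nth L i) ≡ false
  not-deleted i i< = BoolP.not-injective (proj₂ (member i i<))

  rows-increasing : ∀ {l} → l ≡ length L → Increasing (rows {l})
  rows-increasing ≡.refl {i} {j} i<j = sorted (toℕ i) (toℕ j) i<j (FinP.toℕ<n j)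

  rows-partition : ∀ {l} → l ≡ length L → Partition (suc E) (rows {l}) e
  rows-partition ≡.refl = record
    { κ< = λ a → ℕP.m<n⇒m<1+n (proj₁ (member (toℕ a) (FinP.toℕ<n a)))
    ; ε< = λ b → s≤s (e≤E b)
    ; disj = disj
    ; cover = cover }
    where
    e≤E : ∀ b → e b ℕ.≤ E
    e≤E b with b FinP.≟ fromℕ k
    ... | yes ≡.refl = ℕP.≤-refl
    ... | no b≢k     = ℕP.<⇒≤ (inc (<-fromℕ b b≢k))
    disj : ∀ a b → rows a ≢ e b
    disj a b eq with b FinP.≟ fromℕ k
    ... | yes ≡.refl = ℕP.<⇒≢ (proj₁ (member (toℕ a) (FinP.toℕ<n a))) eq
    ... | no b≢k with not-fromℕ⇒inject₁ b b≢k
    ...   | b′ , ≡.refl with () ← ≡.trans (≡.sym (exponent⇒deleted e (rows a) b′ (≡.sym eq))) (not-deleted (toℕ a) (FinP.toℕ<n a))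
    cover : ∀ v → v ℕ.< suc E → (∃ λ a → rows a ≡ v) ⊎ (∃ λ b → e b ≡ v)
    cover v v≤E with <-suc-cases v≤E
    ... | inj₂ ≡.refl = inj₂ (fromℕ k , ≡.refl)
    ... | inj₁ v<E with deleted e v in del
    ...   | true  = let (b , eb≡v) = deleted⇒exponent e v del in inj₂ (inject₁ b , eb≡v)
    ...   | false = let (i , i< , eq) = complete v v<E (≡.cong not del) in
                    inj₁ (fromℕ< i< , ≡.trans (≡.cong (nth L) (FinP.toℕ-fromℕ< i<)) eq)

  length-kept : k ℕ.≤ E → length L ≡ rOf e
  length-kept k≤E = ℕP.+-cancelʳ-≡ k (length L) (rOf e) (begin
    length L ℕ.+ k  ≡⟨ ℕP.suc-injective (≡.trans (≡.sym (ℕP.+-suc (length L) k)) size) ⟩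
    E               ≡⟨ ℕP.m∸n+n≡m k≤E ⟨
    rOf e ℕ.+ k     ∎)
    where
    open ≡.≡-Reasoning
    size : length L ℕ.+ suc k ≡ suc E
    size = partition-size rows e (rows-increasing ≡.refl) inc (rows-partition ≡.refl)

twice-triangular : ∀ k → Σℕ< (suc k) (λ b → b) ℕ.* 2 ≡ suc k ℕ.* k
twice-triangular zero    = ≡.refl
twice-triangular (suc k) = begin
  Σℕ< (suc (suc k)) (λ b → b) ℕ.* 2               ≡⟨ ≡.cong (ℕ._* 2) (Σℕ<-snoc (suc k) (λ b → b)) ⟩
  (Σℕ< (suc k) (λ b → b) ℕ.+ suc k) ℕ.* 2         ≡⟨ ℕP.*-distribʳ-+ 2 (Σℕ< (suc k) (λ b → b)) (suc k) ⟩
  Σℕ< (suc k) (λ b → b) ℕ.* 2 ℕ.+ suc k ℕ.* 2     ≡⟨ ≡.cong (ℕ._+ suc k ℕ.* 2) (twice-triangular k) ⟩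
  suc k ℕ.* k ℕ.+ suc k ℕ.* 2                     ≡⟨ step k ⟩
  suc (suc k) ℕ.* suc k                           ∎
  where
  open ≡.≡-Reasoning
  step : ∀ k → suc k ℕ.* k ℕ.+ suc k ℕ.* 2 ≡ suc (suc k) ℕ.* suc k
  step = solve-∀

triangular : ∀ k → (suc k ℕ.* k) / 2 ≡ Σℕ< (suc k) (λ b → b)
triangular k = ≡.trans (≡.cong (_/ 2) (≡.sym (twice-triangular k))) (m*n/n≡m (Σℕ< (suc k) (λ b → b)) 2)

expSum-last : ∀ k (e : Fin (suc k) → ℕ) → expSum e ℕ.+ e (fromℕ k) ≡ Σℕ e ℕ.+ k
expSum-last zero    e = ≡.sym (≡.trans (ℕP.+-identityʳ _) (ℕP.+-identityʳ _))
expSum-last (suc k) e = begin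
  suc (e zero ℕ.+ expSum (e ∘ suc)) ℕ.+ e (suc (fromℕ k))     ≡⟨ ≡.cong suc (ℕP.+-assoc (e zero) _ _) ⟩
  suc (e zero ℕ.+ (expSum (e ∘ suc) ℕ.+ e (suc (fromℕ k))))   ≡⟨ ≡.cong (λ z → suc (e zero ℕ.+ z)) (expSum-last k (e ∘ suc)) ⟩
  suc (e zero ℕ.+ (Σℕ (e ∘ suc) ℕ.+ k))                       ≡⟨ ≡.cong suc (ℕP.+-assoc (e zero) _ _) ⟨
  suc (e zero ℕ.+ Σℕ (e ∘ suc) ℕ.+ k)                         ≡⟨ ℕP.+-suc _ k ⟨
  e zero ℕ.+ Σℕ (e ∘ suc) ℕ.+ suc k                           ∎
  where open ≡.≡-Reasoning

sign-exponents : ∀ k (e : Fin (suc k) → ℕ) r → r ℕ.+ k ≡ e (fromℕ k) →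
  Σℕ< (suc k) (λ b → b) ℕ.+ Σℕ e ℕ.+ r ℕ.+ (k ℕ.+ k)
    ≡ (suc k ℕ.* k) / 2 ℕ.+ expSum e ℕ.+ (e (fromℕ k) ℕ.+ e (fromℕ k))
sign-exponents k e r r+k≡E = begin
  Tₙ ℕ.+ Σℕ e ℕ.+ r ℕ.+ (k ℕ.+ k)             ≡⟨ regroup Tₙ (Σℕ e) r k ⟩
  Tₙ ℕ.+ ((Σℕ e ℕ.+ k) ℕ.+ (r ℕ.+ k))         ≡⟨ ≡.cong₂ (λ s t → Tₙ ℕ.+ (s ℕ.+ t)) (≡.sym (expSum-last k e)) r+k≡E ⟩
  Tₙ ℕ.+ ((expSum e ℕ.+ E) ℕ.+ E)             ≡⟨ regroup′ Tₙ (expSum e) E ⟩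
  Tₙ ℕ.+ expSum e ℕ.+ (E ℕ.+ E)               ≡⟨ ≡.cong (λ t → t ℕ.+ expSum e ℕ.+ (E ℕ.+ E)) (triangular k) ⟨
  (suc k ℕ.* k) / 2 ℕ.+ expSum e ℕ.+ (E ℕ.+ E) ∎
  where
  open ≡.≡-Reasoning
  Tₙ = Σℕ< (suc k) (λ b → b)
  E = e (fromℕ k)
  regroup : ∀ Tₙ S r k → Tₙ ℕ.+ S ℕ.+ r ℕ.+ (k ℕ.+ k) ≡ Tₙ ℕ.+ ((S ℕ.+ k) ℕ.+ (r ℕ.+ k))
  regroup = solve-∀
  regroup′ : ∀ Tₙ X E → Tₙ ℕ.+ ((X ℕ.+ E) ℕ.+ E) ≡ Tₙ ℕ.+ X ℕ.+ (E ℕ.+ E)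
  regroup′ = solve-∀

mainTheorem5 : {c ℓ : Level} (R : CommutativeRing c ℓ) (k : ℕ)
    (x : Fin (suc k) → CommutativeRing.Carrier R) (e : Fin (suc k) → ℕ) →
    (∀ {i j : Fin (suc k)} → i Fin.< j → e i ℕ.< e j) →
    suc k ℕ.≤ e (fromℕ k) →
    CommutativeRing._≈_ R (genVdm R x e)
      (CommutativeRing._*_ R
        (CommutativeRing._*_ R
          (sgn R ((suc k ℕ.* k) / 2 ℕ.+ expSum e))
          (det R (Qmat R x e)))
        (genVdm R x toℕ))
mainTheorem5 R k x e inc n≤E = begin
  genVdm R x e                                            ≈⟨ sgn-cancel Z _ _ (sym (reduction r κ e κ-increasing inc κ⊔e)) ⟩
  sgn R Z * (det R (Qmat R x e) * genVdm R x toℕ)         ≈⟨ *-congʳ (sgn-parity Z W k E (sign-exponents k e r r+k≡E)) ⟩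
  sgn R W * (det R (Qmat R x e) * genVdm R x toℕ)         ≈⟨ *-assoc _ _ _ ⟨
  (sgn R W * det R (Qmat R x e)) * genVdm R x toℕ         ∎
  where
  open CommutativeRing R using (_*_; sym; *-congʳ; *-assoc)
  open import Relation.Binary.Reasoning.Setoid (CommutativeRing.setoid R)
  open Determinants R using (sgn-cancel; sgn-parity)
  open Reduction R k x using (reduction)
  open KeptRows e inc using (rows; rows-increasing; rows-partition; length-kept)
  E = e (fromℕ k)
  r = rOf e
  r+k≡E : r ℕ.+ k ≡ E
  r+k≡E = ℕP.m∸n+n≡m (ℕP.<⇒≤ n≤E)
  κ : Fin r → ℕ
  κ = rows
  κ-increasing : Increasing κ
  κ-increasing = rows-increasing (≡.sym (length-kept (ℕP.<⇒≤ n≤E)))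
  κ⊔e : Partition (r ℕ.+ suc k) κ e
  κ⊔e = ≡.subst (λ N → Partition N κ e) (≡.sym (≡.trans (ℕP.+-suc r k) (≡.cong suc r+k≡E)))
                (rows-partition (≡.sym (length-kept (ℕP.<⇒≤ n≤E))))
  Z = Σℕ< (suc k) (λ b → b) ℕ.+ Σℕ e ℕ.+ r
  W = (suc k ℕ.* k) / 2 ℕ.+ expSum e
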